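{- Let $s=\sum_{n=1}^{p-2}(1+\sigma_n-\sigma_{1+n})[n^{ -1}]\in\mathbb Z[\Delta]$. (a) For every odd $\psi\in\widehat\Delta$ with $\psi\neq\omega$, $e_\psi s\in\mathbb Z_p^*e_\psi$. (b) $\frac1p e_\omega s\in\mathbb Z_p^*e_\omega$.
   Context: Let $p\ge5$ be prime, $\Delta=\mathrm{Gal}(\mathbb Q(\zeta_p)/\mathbb Q)$, $\sigma_a\in\Delta$ with $\sigma_a(\zeta_p)=\zeta_p^a$ ($a$ prime to $p$). $\widehat\Delta=\mathrm{Hom}(\Delta,\mathbb Z_p^*)$, $\omega$ the Teichmüller character ($\sigma(\zeta_p)=\zeta_p^{\omega(\sigma)}$); $\psi$ is odd if $\psi(\sigma_{ -1})=-1$. For $\rho\in\widehat\Delta$, $e_\rho=\frac1{p-1}\sum_{\delta\in\Delta}\rho^{ -1}(\delta)\delta\in\mathbb Z_p[\Delta]$. For $x\in\mathbb Z_p$, $[x]\in\{0,\dots,p-1\}$ denotes the integer with $x\equiv[x]\pmod p$, and $n^{ -1}$ is the inverse of $n$ modulo $p$. -}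

module Defs where

open import Data.Nat as ℕ using (ℕ; zero; suc; NonZero; _≡ᵇ_)
open import Data.Nat.DivMod using (_%_)
open import Data.Bool using (if_then_else_)
open import Data.Integer as ℤ using (ℤ; +_; -_; _-_; _+_; _*_; _^_)
open import Data.Integer.Divisibility using (_∣_)
open import Data.Product using (Σ; _×_)
open import Relation.Nullary using (¬_)

-- p-adic integers, concretely: an element of ℤ_p is a sequence x : ℕ → ℤ
-- with x (k+1) ≡ x k (mod p^k) (x k is the approximation mod p^k).

Seq : Set
Seq = ℕ → ℤ

IsZp : ℕ → Seq → Set
IsZp p x = ∀ k → (+ (p ℕ.^ k)) ∣ (x (suc k) - x k)

_≈[_]_ : Seq → ℕ → Seq → Set
x ≈[ p ] y = ∀ k → (+ (p ℕ.^ k)) ∣ (x k - y k)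

cst : ℤ → Seq
cst z = λ _ → z

_⊕_ : Seq → Seq → Seq
(x ⊕ y) k = x k + y k

_⊗_ : Seq → Seq → Seq
(x ⊗ y) k = x k * y k

IsUnit : ℕ → Seq → Set
IsUnit p u = IsZp p u × Σ Seq (λ v → IsZp p v × ((u ⊗ v) ≈[ p ] cst (+ 1)))

sumℤ : ℕ → (ℕ → ℤ) → ℤ
sumℤ zero    f = + 0
sumℤ (suc n) f = sumℤ n f + f (suc n)

sumSeq : ℕ → (ℕ → Seq) → Seq
sumSeq n f k = sumℤ n (λ a → f a k)

-- 1/(p-1) in ℤ_p : approximations -(1 + p + ... + p^k)
invPm1 : ℕ → Seq
invPm1 p k = - (+ 1 + sumℤ k (λ j → + (p ℕ.^ j)))

-- Δ = Gal(Q(ζ_p)/Q) identified with (ℤ/p)^* via a ↦ σ_a, elements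
-- represented by a ∈ {1,…,p-1}.

InΔ : ℕ → ℕ → Set
InΔ p a = 1 ℕ.≤ a × a ℕ.< p

invAux : (p : ℕ) .{{_ : NonZero p}} → ℕ → ℕ → ℕ
invAux p a zero    = 0
invAux p a (suc b) = if ((a ℕ.* suc b) % p) ≡ᵇ 1 then suc b else invAux p a b

inv : (p : ℕ) .{{_ : NonZero p}} → ℕ → ℕ
inv p a = invAux p a (p ℕ.∸ 1)

mulΔ : (p : ℕ) .{{_ : NonZero p}} → ℕ → ℕ → ℕ
mulΔ p a b = (a ℕ.* b) % p

-- Group ring ℤ_p[Δ]: functions Δ → ℤ_p  (x = Σ_a x(a) σ_a)

GR : Set
GR = ℕ → Seq

_⋆[_]_ : GR → (p : ℕ) → .{{_ : NonZero p}} → GR → GR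
(x ⋆[ p ] y) c = sumSeq (p ℕ.∸ 1) (λ a → x a ⊗ y (mulΔ p c (inv p a)))

_≈GR[_]_ : GR → ℕ → GR → Set
x ≈GR[ p ] y = ∀ c → InΔ p c → x c ≈[ p ] y c

_·_ : Seq → GR → GR
(u · x) c = u ⊗ x c

IsChar : (p : ℕ) .{{_ : NonZero p}} → (ℕ → Seq) → Set
IsChar p ψ = (∀ a → InΔ p a → IsUnit p (ψ a))
           × (∀ a b → InΔ p a → InΔ p b → ψ (mulΔ p a b) ≈[ p ] (ψ a ⊗ ψ b))

-- ψ odd: ψ(σ_{-1}) = -1
IsOdd : ℕ → (ℕ → Seq) → Set
IsOdd p ψ = ψ (p ℕ.∸ 1) ≈[ p ] cst (- (+ 1))

-- Teichmüller character: ω(σ_a) = lim a^(p^k)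
ω : ℕ → ℕ → Seq
ω p a k = (+ a) ^ (p ℕ.^ k)

-- idempotent e_ρ = 1/(p-1) Σ_δ ρ⁻¹(δ) δ, with ρ⁻¹(δ) = ρ(δ⁻¹)
e : (p : ℕ) .{{_ : NonZero p}} → (ℕ → Seq) → GR
e p ρ c = invPm1 p ⊗ ρ (inv p c)

-- Kronecker delta as group-ring basis element σ_b
σ : ℕ → GR
σ b c = cst (if c ≡ᵇ b then + 1 else + 0)

s : (p : ℕ) .{{_ : NonZero p}} → GR
s p c = sumSeq (p ℕ.∸ 2) (λ n → λ k →
          (+ (inv p n)) * ((σ 1 c k + σ n c k) - σ (suc n) c k))

module Submission where

import Defs
open import Data.Nat using (ℕ; zero; suc; s≤s; NonZero; _≤_)
open import Data.Nat.Primality using (Prime)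
open import Data.Integer using (+_)
open import Data.Product using (Σ; _×_; _,_)
open import Relation.Nullary using (¬_)

-- Since e_ψ σ_b = ψ(b) e_ψ, one has e_ψ s = s_ψ e_ψ with the scalar
-- s_ψ = ∑ [n⁻¹] (ψ(1) + ψ(n) - ψ(n+1)) ∈ ℤ_p (GroupRing), and a p-adic integer is a
-- unit as soon as it is nonzero modulo p (PadicUnits).
-- (a) Modulo p every character is b ↦ b^m (CharactersModP, by Lagrange interpolation
--     on Δ and vanishing power sums); ψ odd forces m odd, ψ ≠ ω excludes m = 1
--     (Teichmuller), and then s_ψ ≡ -A_m ≡ m ≢ 0 where A_m = ∑ n⁻¹((1+n)^m - n^m - 1)
--     is evaluated by a recursion in m (TwistedSums).
-- (b) For ω, s_ω ≡ -A_1 = 0 (mod p), while modulo p² one has ω(b) ≡ b^p and the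
--     binomial expansion of A_p gives s_ω ≡ p, so s_ω / p is a unit.

module Congruence where

  open import Data.Nat as ℕ using (ℕ; zero; suc; _<_; NonZero)
  import Data.Nat.Properties as ℕP
  import Data.Nat.Divisibility as ℕD
  open import Data.Integer as ℤ using (ℤ; +_; -_; _-_; _+_; _*_; _^_; _%ℕ_; _/ℕ_)
  open import Data.Integer.DivMod using (a≡a%ℕn+[a/ℕn]*n)
  import Data.Integer.Properties as ℤP
  open import Data.Integer.Divisibility.Signed as S using (divides)
  import Data.Integer.Divisibility as U
  open import Data.Integer.Tactic.RingSolver using (solve-∀)
  open import Relation.Binary.PropositionalEquality
  open import Data.Sum using (_⊎_; inj₁; inj₂)
  open import Relation.Nullary using (¬_; Dec; map′)
  open import Data.Empty using (⊥-elim)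
  open import Data.Nat.Primality using (Prime; euclidsLemma)

  -- Congruence of integers modulo a natural number m, packaged as a record
  -- so that the modulus stays visible to type inference.
  infix 4 _≅_[_]
  record _≅_[_] (a b : ℤ) (m : ℕ) : Set where
    constructor mk
    field un : (+ m) S.∣ (a - b)
  open _≅_[_] public

  private
    variable
      a b c d : ℤ
      m n : ℕ

  ≅-from-∣ : a - b ≡ c → (+ m) S.∣ c → a ≅ b [ m ]
  ≅-from-∣ {m = m} eq x = mk (subst ((+ m) S.∣_) (sym eq) x)

  ≅-reflexive : a ≡ b → a ≅ b [ m ]
  ≅-reflexive {a = a} {m = m} refl = mk (divides (+ 0) (trans (ℤP.+-inverseʳ a) (sym (ℤP.*-zeroˡ (+ m)))))

  ≅-refl : a ≅ a [ m ]
  ≅-refl = ≅-reflexive refl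

  ≅-sym : a ≅ b [ m ] → b ≅ a [ m ]
  ≅-sym {a = a} {b = b} (mk x) = mk (subst ((+ _) S.∣_) (flip a b) (S.∣m⇒∣-m x))
    where flip : ∀ a b → - (a - b) ≡ b - a
          flip = solve-∀

  ≅-trans : a ≅ b [ m ] → b ≅ c [ m ] → a ≅ c [ m ]
  ≅-trans {a = a} {b = b} {c = c} (mk x) (mk y) = ≅-from-∣ (split a b c) (S.∣m∣n⇒∣m+n x y)
    where split : ∀ a b c → a - c ≡ (a - b) + (b - c)
          split = solve-∀

  ≅-+ : a ≅ b [ m ] → c ≅ d [ m ] → a + c ≅ b + d [ m ]
  ≅-+ {a = a} {b = b} {c = c} {d = d} (mk x) (mk y) = ≅-from-∣ (split a b c d) (S.∣m∣n⇒∣m+n x y)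
    where split : ∀ a b c d → (a + c) - (b + d) ≡ (a - b) + (c - d)
          split = solve-∀

  ≅-neg : a ≅ b [ m ] → - a ≅ - b [ m ]
  ≅-neg {a = a} {b = b} (mk x) = ≅-from-∣ (split a b) (S.∣m⇒∣-m x)
    where split : ∀ a b → - a - - b ≡ - (a - b)
          split = solve-∀

  ≅-- : a ≅ b [ m ] → c ≅ d [ m ] → a - c ≅ b - d [ m ]
  ≅-- x y = ≅-+ x (≅-neg y)

  ≅-* : a ≅ b [ m ] → c ≅ d [ m ] → a * c ≅ b * d [ m ]
  ≅-* {a = a} {b = b} {c = c} {d = d} (mk x) (mk y) =
    ≅-from-∣ (split a b c d) (S.∣m∣n⇒∣m+n (S.∣m⇒∣m*n c x) (S.∣n⇒∣m*n b y))
    where split : ∀ a b c d → a * c - b * d ≡ (a - b) * c + b * (c - d)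
          split = solve-∀

  ≅-*l : ∀ c → a ≅ b [ m ] → c * a ≅ c * b [ m ]
  ≅-*l c x = ≅-* (≅-refl {c}) x

  ≅-*r : ∀ c → a ≅ b [ m ] → a * c ≅ b * c [ m ]
  ≅-*r c x = ≅-* x (≅-refl {c})

  ≅-^ : a ≅ b [ m ] → ∀ k → a ^ k ≅ b ^ k [ m ]
  ≅-^ x zero = ≅-refl
  ≅-^ x (suc k) = ≅-* x (≅-^ x k)

  ∣⇒≅0 : (+ m) S.∣ a → a ≅ + 0 [ m ]
  ∣⇒≅0 {m = m} {a = a} x = mk (subst ((+ m) S.∣_) (sym (ℤP.+-identityʳ a)) x)

  ≅0⇒∣ : a ≅ + 0 [ m ] → (+ m) S.∣ a
  ≅0⇒∣ {a = a} {m = m} (mk x) = subst ((+ m) S.∣_) (ℤP.+-identityʳ a) x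

  ≅-multiple : ∀ (q : ℤ) → q * + m ≅ + 0 [ m ]
  ≅-multiple q = ∣⇒≅0 (divides q refl)

  ≅⇒diff≅0 : a ≅ b [ m ] → a - b ≅ + 0 [ m ]
  ≅⇒diff≅0 x = ∣⇒≅0 (un x)

  diff≅0⇒≅ : a - b ≅ + 0 [ m ] → a ≅ b [ m ]
  diff≅0⇒≅ x = mk (≅0⇒∣ x)

  ≅0? : ∀ a m → Dec (a ≅ + 0 [ m ])
  ≅0? a m = map′ ∣⇒≅0 ≅0⇒∣ ((+ m) S.∣? a)

  ≅-mod-1 : a ≅ b [ 1 ]
  ≅-mod-1 {a = a} {b = b} = mk (divides (a - b) (sym (ℤP.*-identityʳ (a - b))))

  ≅-modulus : m ≡ n → a ≅ b [ m ] → a ≅ b [ n ]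
  ≅-modulus refl x = x

  ≅-weaken : m ℕD.∣ n → a ≅ b [ n ] → a ≅ b [ m ]
  ≅-weaken {m = m} {n = n} d (mk x) = mk (S.∣-trans (S.∣ᵤ⇒∣ {+ m} {+ n} d) x)

  ≅0-* : a ≅ + 0 [ m ] → b ≅ + 0 [ n ] → a * b ≅ + 0 [ m ℕ.* n ]
  ≅0-* {a = a} {m = m} {b = b} {n = n} x y with ≅0⇒∣ x | ≅0⇒∣ y
  ... | divides u eu | divides v ev = ∣⇒≅0 (divides (u * v) (begin
    a * b                  ≡⟨ cong₂ _*_ eu ev ⟩
    u * + m * (v * + n)    ≡⟨ regroup u (+ m) v (+ n) ⟩
    u * v * (+ m * + n)    ≡⟨ cong (u * v *_) (ℤP.pos-* m n) ⟨
    u * v * + (m ℕ.* n)    ∎))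
    where open ≡-Reasoning
          regroup : ∀ u m v n → u * m * (v * n) ≡ u * v * (m * n)
          regroup = solve-∀

  ≅0-*-≅ : a ≅ + 0 [ m ] → b ≅ c [ n ] → a * b ≅ a * c [ m ℕ.* n ]
  ≅0-*-≅ {a = a} {b = b} {c = c} a≅0 b≅c = diff≅0⇒≅ (≅-trans (≅-reflexive (factor a b c)) (≅0-* a≅0 (≅⇒diff≅0 b≅c)))
    where factor : ∀ a b c → a * b - a * c ≡ a * (b - c)
          factor = solve-∀

  %ℕ-≅ : ∀ x → .{{_ : NonZero m}} → + (x %ℕ m) ≅ x [ m ]
  %ℕ-≅ {m = m} x = ≅-from-∣ (rearrange (+ (x %ℕ m)) (x /ℕ m) (+ m) x (a≡a%ℕn+[a/ℕn]*n x m)) (S.∣m⇒∣-m (S.∣m⇒∣m*n {+ m} {+ m} (x /ℕ m) S.∣-refl))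
    where rearrange : ∀ r d m x → x ≡ r + d * m → r - x ≡ - (m * d)
          rearrange r d m x refl = identity r d m
            where identity : ∀ r d m → r - (r + d * m) ≡ - (m * d)
                  identity = solve-∀

  toU : a ≅ b [ m ] → (+ m) U.∣ (a - b)
  toU (mk x) = S.∣⇒∣ᵤ x

  fromU : (+ m) U.∣ (a - b) → a ≅ b [ m ]
  fromU x = mk (S.∣ᵤ⇒∣ x)

  small-≇0 : 0 < n → n < m → ¬ (+ n ≅ + 0 [ m ])
  small-≇0 {n} 0<n n<m x = ℕP.<⇒≱ n<m (ℕD.∣⇒≤ ⦃ ℕ.>-nonZero 0<n ⦄ (S.∣⇒∣ᵤ (≅0⇒∣ x)))

  euclidℤ : Prime m → (+ m) S.∣ (a * b) → (+ m) S.∣ a ⊎ (+ m) S.∣ b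
  euclidℤ {m = m} {a = a} {b = b} pr x
    with euclidsLemma (ℤ.∣ a ∣) (ℤ.∣ b ∣) pr (subst (m ℕD.∣_) (ℤP.abs-* a b) (S.∣⇒∣ᵤ x))
  ... | inj₁ y = inj₁ (S.∣ᵤ⇒∣ y)
  ... | inj₂ y = inj₂ (S.∣ᵤ⇒∣ y)

  cancel : Prime m → ¬ (c ≅ + 0 [ m ]) → c * a ≅ c * b [ m ] → a ≅ b [ m ]
  cancel {m = m} {c = c} {a = a} {b = b} pr c≇0 x
    with euclidℤ {a = c} {b = a - b} pr (subst ((+ m) S.∣_) (factor c a b) (un x))
    where factor : ∀ c a b → c * a - c * b ≡ c * (a - b)
          factor = solve-∀
  ... | inj₁ y = ⊥-elim (c≇0 (∣⇒≅0 y))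
  ... | inj₂ y = mk y

module FiniteSum where

  open import Data.Nat using (ℕ; zero; suc; _<_)
  import Data.Nat.Properties as ℕP
  open import Data.Integer using (ℤ; +_; -_; _-_; _+_; _*_)
  import Data.Integer.Properties as ℤP
  open import Data.Integer.Tactic.RingSolver using (solve-∀)
  open import Relation.Binary.PropositionalEquality
  open import Relation.Nullary using (yes; no)
  open import Defs using (sumℤ)
  open Congruence

  -- ∑ n f = f 0 + ... + f (n-1).  Indexing from 0 makes peeling off the
  -- last term definitional; Defs.sumℤ (indexed from 1) is translated into it.
  ∑ : ℕ → (ℕ → ℤ) → ℤ
  ∑ zero f = + 0
  ∑ (suc n) f = ∑ n f + f n

  sumℤ≡∑ : ∀ n f → sumℤ n f ≡ ∑ n (λ i → f (suc i))
  sumℤ≡∑ zero f = refl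
  sumℤ≡∑ (suc n) f = cong (_+ f (suc n)) (sumℤ≡∑ n f)

  ∑-cong : ∀ n {f g} → (∀ i → i < n → f i ≡ g i) → ∑ n f ≡ ∑ n g
  ∑-cong zero h = refl
  ∑-cong (suc n) h = cong₂ _+_ (∑-cong n (λ i i<n → h i (ℕP.m<n⇒m<1+n i<n))) (h n ℕP.≤-refl)

  ∑-cong≅ : ∀ n {f g m} → (∀ i → i < n → f i ≅ g i [ m ]) → ∑ n f ≅ ∑ n g [ m ]
  ∑-cong≅ zero h = ≅-refl
  ∑-cong≅ (suc n) h = ≅-+ (∑-cong≅ n (λ i i<n → h i (ℕP.m<n⇒m<1+n i<n))) (h n ℕP.≤-refl)

  ∑-+ : ∀ n f g → ∑ n (λ i → f i + g i) ≡ ∑ n f + ∑ n g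
  ∑-+ zero f g = refl
  ∑-+ (suc n) f g = trans (cong (_+ (f n + g n)) (∑-+ n f g)) (interchange (∑ n f) (∑ n g) (f n) (g n))
    where interchange : ∀ a b c d → a + b + (c + d) ≡ a + c + (b + d)
          interchange = solve-∀

  ∑-neg : ∀ n f → ∑ n (λ i → - f i) ≡ - ∑ n f
  ∑-neg zero f = refl
  ∑-neg (suc n) f = trans (cong (_+ (- f n)) (∑-neg n f)) (sym (ℤP.neg-distrib-+ (∑ n f) (f n)))

  ∑-- : ∀ n f g → ∑ n (λ i → f i - g i) ≡ ∑ n f - ∑ n g
  ∑-- n f g = trans (∑-+ n f (λ i → - g i)) (cong (λ x → ∑ n f + x) (∑-neg n g))

  ∑-*l : ∀ n c f → ∑ n (λ i → c * f i) ≡ c * ∑ n f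
  ∑-*l zero c f = sym (ℤP.*-zeroʳ c)
  ∑-*l (suc n) c f = trans (cong (_+ c * f n) (∑-*l n c f)) (sym (ℤP.*-distribˡ-+ c (∑ n f) (f n)))

  ∑-*r : ∀ n c f → ∑ n (λ i → f i * c) ≡ ∑ n f * c
  ∑-*r n c f = trans (∑-cong n (λ i _ → ℤP.*-comm (f i) c)) (trans (∑-*l n c f) (ℤP.*-comm c (∑ n f)))

  ∑-zero : ∀ n → ∑ n (λ _ → + 0) ≡ + 0
  ∑-zero zero = refl
  ∑-zero (suc n) = cong (_+ + 0) (∑-zero n)

  ∑-const : ∀ n c → ∑ n (λ _ → c) ≡ + n * c
  ∑-const zero c = sym (ℤP.*-zeroˡ c)
  ∑-const (suc n) c = trans (cong (_+ c) (∑-const n c)) (one-more (+ n) c)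
    where one-more : ∀ n c → n * c + c ≡ (+ 1 + n) * c
          one-more = solve-∀

  ∑-swap : ∀ n k (f : ℕ → ℕ → ℤ) → ∑ n (λ i → ∑ k (λ j → f i j)) ≡ ∑ k (λ j → ∑ n (λ i → f i j))
  ∑-swap zero k f = sym (∑-zero k)
  ∑-swap (suc n) k f = begin
    ∑ n (λ i → ∑ k (λ j → f i j)) + ∑ k (λ j → f n j) ≡⟨ cong (_+ ∑ k (λ j → f n j)) (∑-swap n k f) ⟩
    ∑ k (λ j → ∑ n (λ i → f i j)) + ∑ k (λ j → f n j) ≡⟨ sym (∑-+ k _ _) ⟩
    ∑ k (λ j → ∑ n (λ i → f i j) + f n j) ∎
    where open ≡-Reasoning

  ∑-first : ∀ n f → ∑ (suc n) f ≡ f 0 + ∑ n (λ i → f (suc i))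
  ∑-first zero f = ℤP.+-comm (+ 0) (f 0)
  ∑-first (suc n) f = trans (cong (_+ f (suc n)) (∑-first n f)) (ℤP.+-assoc (f 0) _ _)

  ∑-telescope : ∀ n (g : ℕ → ℤ) → ∑ n (λ i → g (suc i) - g i) ≡ g n - g 0
  ∑-telescope zero g = sym (ℤP.+-inverseʳ (g 0))
  ∑-telescope (suc n) g = trans (cong (_+ (g (suc n) - g n)) (∑-telescope n g)) (cancel-middle (g n) (g 0) (g (suc n)))
    where cancel-middle : ∀ a b c → a - b + (c - a) ≡ c - b
          cancel-middle = solve-∀

  ∑-vanish≅ : ∀ n {f m} → (∀ i → i < n → f i ≅ + 0 [ m ]) → ∑ n f ≅ + 0 [ m ]
  ∑-vanish≅ zero h = ≅-refl
  ∑-vanish≅ (suc n) h = ≅-+ (∑-vanish≅ n (λ i i<n → h i (ℕP.m<n⇒m<1+n i<n))) (h n ℕP.≤-refl)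

  ∑-single≅ : ∀ n a f {m} → a < n → (∀ i → i < n → i ≢ a → f i ≅ + 0 [ m ]) → ∑ n f ≅ f a [ m ]
  ∑-single≅ (suc n) a f a<n h with a ℕP.≟ n
  ... | yes refl = ≅-trans (≅-+ (∑-vanish≅ a (λ i i<a → h i (ℕP.m<n⇒m<1+n i<a) (ℕP.<⇒≢ i<a))) ≅-refl)
                           (≅-reflexive (ℤP.+-identityˡ (f a)))
  ... | no a≢n = ≅-trans (≅-+ (∑-single≅ n a f (ℕP.≤∧≢⇒< (ℕP.≤-pred a<n) a≢n) (λ i i<n → h i (ℕP.m<n⇒m<1+n i<n)))
                              (h n ℕP.≤-refl (λ e → a≢n (sym e))))
                         (≅-reflexive (ℤP.+-identityʳ (f a)))

module Binomial where

  open import Data.Nat as ℕ using (ℕ; zero; suc; _<_; s≤s; z≤n)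
  import Data.Nat.Properties as ℕP
  import Data.Nat.Divisibility as ℕD
  open import Data.Nat.Combinatorics using (_C_; nCk+nC[k+1]≡[n+1]C[k+1]; k>n⇒nCk≡0; nCn≡1; nC1≡n)
  import Data.Nat.Tactic.RingSolver as ℕSolver
  open import Data.Integer using (ℤ; +_; _+_; _*_; _^_; _%ℕ_)
  open import Data.Integer.DivMod using (n%ℕd<d)
  import Data.Integer.Properties as ℤP
  open import Data.Integer.Tactic.RingSolver using (solve-∀)
  open import Relation.Binary.PropositionalEquality
  open import Data.Empty using (⊥-elim)
  open import Relation.Nullary using (¬_)
  open import Data.Sum using (inj₁; inj₂)
  open import Data.Nat.Primality using (Prime; euclidsLemma)
  import Data.Integer.Divisibility.Signed as S
  open Congruence
  open FiniteSum

  pascal : ∀ n k → suc n C suc k ≡ n C k ℕ.+ n C suc k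
  pascal n k = sym (nCk+nC[k+1]≡[n+1]C[k+1] n k)

  -- Absorption identity (k+1)·C(n+1,k+1) = (n+1)·C(n,k); it shows p ∣ C(p,j).
  absorption : ∀ n k → suc k ℕ.* (suc n C suc k) ≡ suc n ℕ.* (n C k)
  absorption zero zero = refl
  absorption zero (suc k) = trans (cong (suc (suc k) ℕ.*_) (k>n⇒nCk≡0 {1} {suc (suc k)} (s≤s (s≤s z≤n)))) (ℕP.*-zeroʳ (suc (suc k)))
  absorption (suc n) zero = trans (ℕP.*-identityˡ _) (trans (nC1≡n (suc (suc n))) (sym (ℕP.*-identityʳ _)))
  absorption (suc n) (suc k) = begin
    suc (suc k) ℕ.* (suc (suc n) C suc (suc k))
      ≡⟨ cong (suc (suc k) ℕ.*_) (pascal (suc n) (suc k)) ⟩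
    suc (suc k) ℕ.* (X ℕ.+ Y)
      ≡⟨ expand (suc k) X Y ⟩
    X ℕ.+ suc k ℕ.* X ℕ.+ suc (suc k) ℕ.* Y
      ≡⟨ cong₂ (λ u v → X ℕ.+ u ℕ.+ v) (absorption n k) (absorption n (suc k)) ⟩
    X ℕ.+ suc n ℕ.* (n C k) ℕ.+ suc n ℕ.* (n C suc k)
      ≡⟨ collect X (suc n) (n C k) (n C suc k) ⟩
    X ℕ.+ suc n ℕ.* (n C k ℕ.+ n C suc k)
      ≡⟨ cong (λ u → X ℕ.+ suc n ℕ.* u) (pascal n k) ⟨
    suc (suc n) ℕ.* X ∎
    where
    open ≡-Reasoning
    X = suc n C suc k
    Y = suc n C suc (suc k)
    expand : ∀ k X Y → (1 ℕ.+ k) ℕ.* (X ℕ.+ Y) ≡ X ℕ.+ k ℕ.* X ℕ.+ (1 ℕ.+ k) ℕ.* Y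
    expand = ℕSolver.solve-∀
    collect : ∀ X n A B → X ℕ.+ n ℕ.* A ℕ.+ n ℕ.* B ≡ X ℕ.+ n ℕ.* (A ℕ.+ B)
    collect = ℕSolver.solve-∀

  -- The binomial theorem (1+x)^n = ∑_j C(n,j) x^j, summed over any range j < N with n < N
  -- (the surplus terms vanish); the range is kept flexible for the induction.
  binomial-upto : ∀ (x : ℤ) n N → n < N → (+ 1 + x) ^ n ≡ ∑ N (λ j → + (n C j) * x ^ j)
  binomial-upto x zero (suc N) _ = sym (begin
    ∑ (suc N) (λ j → + (0 C j) * x ^ j)       ≡⟨ ∑-first N _ ⟩
    + 1 * + 1 + ∑ N (λ j → + 0 * x ^ suc j)   ≡⟨ cong (λ u → + 1 * + 1 + u) (trans (∑-cong N (λ i _ → ℤP.*-zeroˡ (x ^ suc i))) (∑-zero N)) ⟩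
    + 1                                       ∎)
    where open ≡-Reasoning
  binomial-upto x (suc n) (suc (suc N)) (s≤s n<N+1) = begin
    (+ 1 + x) * (+ 1 + x) ^ n                               ≡⟨ cong ((+ 1 + x) *_) (binomial-upto x n (suc N) n<N+1) ⟩
    (+ 1 + x) * ∑ (suc N) T                                 ≡⟨ cong ((+ 1 + x) *_) split-first ⟩
    (+ 1 + x) * (+ 1 + R)                                   ≡⟨ expand x R ⟩
    + 1 * + 1 + (x * (+ 1 + R) + (R + + 0))                 ≡⟨ cong₂ (λ u v → + 1 * + 1 + (x * u + v)) (sym split-first) (sym drop-top) ⟩
    + 1 * + 1 + (x * ∑ (suc N) T + ∑ (suc N) (λ j → T (suc j)))
        ≡⟨ cong (λ u → + 1 * + 1 + (u + ∑ (suc N) (λ j → T (suc j)))) (sym (∑-*l (suc N) x T)) ⟩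
    + 1 * + 1 + (∑ (suc N) (λ j → x * T j) + ∑ (suc N) (λ j → T (suc j)))
        ≡⟨ cong (λ u → + 1 * + 1 + u) (sym (∑-+ (suc N) _ _)) ⟩
    + 1 * + 1 + ∑ (suc N) (λ j → x * T j + T (suc j))       ≡⟨ cong (λ u → + 1 * + 1 + u) (∑-cong (suc N) (λ j _ → pascal-term j)) ⟩
    + 1 * + 1 + ∑ (suc N) (λ j → + (suc n C suc j) * x ^ suc j) ≡⟨ ∑-first (suc N) _ ⟨
    ∑ (suc (suc N)) (λ j → + (suc n C j) * x ^ j)           ∎
    where
    open ≡-Reasoning
    T : ℕ → ℤ
    T j = + (n C j) * x ^ j
    R = ∑ N (λ j → T (suc j))
    split-first : ∑ (suc N) T ≡ + 1 + R
    split-first = trans (∑-first N T) (cong (_+ R) (ℤP.*-identityʳ (+ 1)))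
    drop-top : ∑ (suc N) (λ j → T (suc j)) ≡ R + + 0
    drop-top = cong (λ u → R + u) (trans (cong (λ u → + u * x ^ suc N) (k>n⇒nCk≡0 n<N+1)) (ℤP.*-zeroˡ (x ^ suc N)))
    expand : ∀ x R → (+ 1 + x) * (+ 1 + R) ≡ + 1 * + 1 + (x * (+ 1 + R) + (R + + 0))
    expand = solve-∀
    pascal-term : ∀ j → x * T j + T (suc j) ≡ + (suc n C suc j) * x ^ suc j
    pascal-term j = trans (collect x (+ (n C j)) (+ (n C suc j)) (x ^ j))
                          (cong (λ u → u * x ^ suc j) (trans (sym (ℤP.pos-+ (n C j) (n C suc j))) (cong +_ (sym (pascal n j)))))
      where collect : ∀ x a b y → x * (a * y) + b * (x * y) ≡ (a + b) * (x * y)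
            collect = solve-∀

  binomial : ∀ (x : ℤ) n → (+ 1 + x) ^ n ≡ ∑ (suc n) (λ j → + (n C j) * x ^ j)
  binomial x n = binomial-upto x n (suc n) ℕP.≤-refl

  prime∣C : ∀ {p} → Prime p → ∀ j → suc j < p → p ℕD.∣ (p C suc j)
  prime∣C {suc q} pr j j+1<p with euclidsLemma (suc j) (suc q C suc j) pr
         (subst (suc q ℕD.∣_) (sym (absorption q j)) (ℕD.m∣m*n (q C j)))
  ... | inj₁ p∣j+1 = ⊥-elim (ℕP.<⇒≱ j+1<p (ℕD.∣⇒≤ p∣j+1))
  ... | inj₂ p∣C = p∣C

  prime∣C≅0 : ∀ {p} → Prime p → ∀ j → suc j < p → + (p C suc j) ≅ + 0 [ p ]
  prime∣C≅0 {p} pr j j+1<p with prime∣C pr j j+1<p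
  ... | ℕD.divides c eq = ∣⇒≅0 (S.divides (+ c) (trans (cong +_ eq) (ℤP.pos-* c p)))

  frobenius : ∀ {p} → Prime p → ∀ (x : ℤ) → (+ 1 + x) ^ p ≅ + 1 + x ^ p [ p ]
  frobenius {suc q} pr x = ≅-trans (≅-reflexive (trans (binomial x (suc q)) split))
    (≅-trans (≅-+ (≅-+ (≅-refl {T 0}) inner≅0) (≅-refl {T (suc q)})) (≅-reflexive ends))
    where
    T : ℕ → ℤ
    T j = + (suc q C j) * x ^ j
    split : ∑ (suc (suc q)) T ≡ T 0 + ∑ q (λ j → T (suc j)) + T (suc q)
    split = cong (_+ T (suc q)) (∑-first q T)
    inner≅0 : ∑ q (λ j → T (suc j)) ≅ + 0 [ suc q ]
    inner≅0 = ∑-vanish≅ q (λ j j<q → ≅-trans (≅-*r (x ^ suc j) (prime∣C≅0 pr j (s≤s j<q))) (≅-reflexive (ℤP.*-zeroˡ (x ^ suc j))))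
    ends : T 0 + + 0 + T (suc q) ≡ + 1 + x ^ suc q
    ends = trans (cong (λ u → + 1 * + 1 + + 0 + + u * x ^ suc q) (nCn≡1 (suc q))) (simplify (x ^ suc q))
      where simplify : ∀ y → + 1 * + 1 + + 0 + + 1 * y ≡ + 1 + y
            simplify = solve-∀

  fermat : ∀ {p} → Prime p → ∀ a → (+ a) ^ p ≅ + a [ p ]
  fermat {suc q} pr zero = ≅-reflexive (ℤP.*-zeroˡ ((+ 0) ^ q))
  fermat {suc q} pr (suc a) = ≅-trans (≅-reflexive (cong (_^ suc q) (ℤP.pos-+ 1 a)))
    (≅-trans (frobenius pr (+ a)) (≅-trans (≅-+ (≅-refl {+ 1} {m = suc q}) (fermat pr a)) (≅-reflexive (sym (ℤP.pos-+ 1 a)))))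

  fermat-unit : ∀ {q} → Prime (suc q) → ∀ a → 0 < a → a < suc q → (+ a) ^ q ≅ + 1 [ suc q ]
  fermat-unit pr a 0<a a<p =
    cancel {c = + a} pr (small-≇0 0<a a<p) (≅-trans (fermat pr a) (≅-reflexive (sym (ℤP.*-identityʳ (+ a)))))

  fermatℤ : ∀ {q} → Prime (suc q) → ∀ x → ¬ (x ≅ + 0 [ suc q ]) → x ^ q ≅ + 1 [ suc q ]
  fermatℤ {q} pr x x≇0 with x %ℕ suc q in eq
  ... | zero = ⊥-elim (x≇0 (≅-trans (≅-sym (%ℕ-≅ x)) (≅-reflexive (cong +_ eq))))
  ... | suc r = ≅-trans (≅-^ (≅-trans (≅-sym (%ℕ-≅ x)) (≅-reflexive (cong +_ eq))) q)
                        (fermat-unit pr (suc r) (s≤s z≤n) (subst (_< suc q) eq (n%ℕd<d x (suc q))))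

module Powers where

  open import Data.Nat as ℕ using (ℕ; zero; suc; _∸_)
  import Data.Nat.Properties as ℕP
  import Data.Nat.Divisibility as ℕD
  open import Data.Integer using (ℤ; +_; -_; _-_; _+_; _*_; _^_)
  import Data.Integer.Properties as ℤP
  open import Data.Integer.Tactic.RingSolver using (solve-∀)
  open import Relation.Binary.PropositionalEquality
  open Congruence
  open FiniteSum

  pos-^ : ∀ a n → + (a ℕ.^ n) ≡ (+ a) ^ n
  pos-^ a zero = refl
  pos-^ a (suc n) = trans (ℤP.pos-* a (a ℕ.^ n)) (cong (λ u → + a * u) (pos-^ a n))

  ^-distribʳ-* : ∀ x y n → (x * y) ^ n ≡ x ^ n * y ^ n
  ^-distribʳ-* x y zero = refl
  ^-distribʳ-* x y (suc n) = trans (cong ((x * y) *_) (^-distribʳ-* x y n)) (interchange x y (x ^ n) (y ^ n))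
    where interchange : ∀ x y X Y → x * y * (X * Y) ≡ x * X * (y * Y)
          interchange = solve-∀

  -- geom n x y = x^(n-1) + x^(n-2) y + ... + y^(n-1), the cofactor of x - y in x^n - y^n.
  geom : ℕ → ℤ → ℤ → ℤ
  geom zero x y = + 0
  geom (suc n) x y = x ^ n + y * geom n x y

  geom-factor : ∀ n x y → (x - y) * geom n x y ≡ x ^ n - y ^ n
  geom-factor zero x y = trans (ℤP.*-zeroʳ (x - y)) (sym (ℤP.+-inverseʳ (+ 1)))
  geom-factor (suc n) x y = begin
    (x - y) * (x ^ n + y * geom n x y)             ≡⟨ distribute x y (x ^ n) (geom n x y) ⟩
    (x - y) * x ^ n + y * ((x - y) * geom n x y)   ≡⟨ cong (λ u → (x - y) * x ^ n + y * u) (geom-factor n x y) ⟩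
    (x - y) * x ^ n + y * (x ^ n - y ^ n)          ≡⟨ cancel-middle x y (x ^ n) (y ^ n) ⟩
    x * x ^ n - y * y ^ n                          ∎
    where open ≡-Reasoning
          distribute : ∀ x y X h → (x - y) * (X + y * h) ≡ (x - y) * X + y * ((x - y) * h)
          distribute = solve-∀
          cancel-middle : ∀ x y X Y → (x - y) * X + y * (X - Y) ≡ x * X - y * Y
          cancel-middle = solve-∀

  geom-diag : ∀ n x → geom (suc n) x x ≡ + (suc n) * x ^ n
  geom-diag zero x = trans (cong (λ u → + 1 + u) (ℤP.*-zeroʳ x)) (trans (ℤP.+-identityʳ (+ 1)) (sym (ℤP.*-identityˡ (+ 1))))
  geom-diag (suc n) x = begin
    x * x ^ n + x * geom (suc n) x x   ≡⟨ cong (λ u → x * x ^ n + x * u) (geom-diag n x) ⟩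
    x * x ^ n + x * (+ suc n * x ^ n)  ≡⟨ collect x (x ^ n) (+ suc n) ⟩
    (+ 1 + + suc n) * (x * x ^ n)      ≡⟨ cong (_* (x * x ^ n)) (sym (ℤP.pos-+ 1 (suc n))) ⟩
    + suc (suc n) * (x * x ^ n)        ∎
    where open ≡-Reasoning
          collect : ∀ x X n → x * X + x * (n * X) ≡ (+ 1 + n) * (x * X)
          collect = solve-∀

  geom-cong : ∀ n x {y y' m} → y ≅ y' [ m ] → geom n x y ≅ geom n x y' [ m ]
  geom-cong zero x c = ≅-refl
  geom-cong (suc n) x c = ≅-+ (≅-refl {x ^ n}) (≅-* c (geom-cong n x c))

  geom-∑ : ∀ n x y → geom n x y ≡ ∑ n (λ j → x ^ (n ∸ suc j) * y ^ j)
  geom-∑ zero x y = refl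
  geom-∑ (suc n) x y = begin
    x ^ n + y * geom n x y                                ≡⟨ cong (λ u → x ^ n + y * u) (geom-∑ n x y) ⟩
    x ^ n + y * ∑ n (λ j → x ^ (n ∸ suc j) * y ^ j)       ≡⟨ cong₂ _+_ (sym (ℤP.*-identityʳ (x ^ n))) (sym (∑-*l n y _)) ⟩
    x ^ n * + 1 + ∑ n (λ j → y * (x ^ (n ∸ suc j) * y ^ j))
      ≡⟨ cong (λ u → x ^ n * + 1 + u) (∑-cong n (λ j _ → swap y (x ^ (n ∸ suc j)) (y ^ j))) ⟩
    x ^ n * + 1 + ∑ n (λ j → x ^ (n ∸ suc j) * (y * y ^ j)) ≡⟨ ∑-first n _ ⟨
    ∑ (suc n) (λ j → x ^ (suc n ∸ suc j) * y ^ j)         ∎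
    where open ≡-Reasoning
          swap : ∀ y X Y → y * (X * Y) ≡ X * (y * Y)
          swap = solve-∀

  lift-once : ∀ {q} k a b → a ≅ b [ suc q ℕ.^ suc k ] → a ^ suc q ≅ b ^ suc q [ suc q ℕ.^ suc (suc k) ]
  lift-once {q} k a b a≅b = diff≅0⇒≅ (≅-trans (≅-reflexive (sym (geom-factor n a b)))
                                                (≅-modulus (ℕP.*-comm (n ℕ.^ suc k) n) (≅0-* (≅⇒diff≅0 a≅b) cofactor≅0)))
    where
    n = suc q
    b≅a : b ≅ a [ n ]
    b≅a = ≅-sym (≅-weaken (ℕD.divides (n ℕ.^ k) (ℕP.*-comm n (n ℕ.^ k))) a≅b)
    cofactor≅0 : geom n a b ≅ + 0 [ n ]
    cofactor≅0 = ≅-trans (geom-cong n a b≅a)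
                         (≅-trans (≅-reflexive (trans (geom-diag q a) (ℤP.*-comm (+ n) (a ^ q)))) (≅-multiple (a ^ q)))

  lift : ∀ {q} k a b → a ≅ b [ suc q ] → a ^ (suc q ℕ.^ k) ≅ b ^ (suc q ℕ.^ k) [ suc q ℕ.^ suc k ]
  lift {q} zero a b a≅b = ≅-modulus (sym (ℕP.*-identityʳ (suc q)))
    (≅-trans (≅-reflexive (ℤP.*-identityʳ a)) (≅-trans a≅b (≅-reflexive (sym (ℤP.*-identityʳ b)))))
  lift {q} (suc k) a b a≅b = ≅-trans (≅-reflexive (unfold a)) (≅-trans (lift-once k _ _ (lift k a b a≅b)) (≅-reflexive (sym (unfold b))))
    where
    unfold : ∀ x → x ^ (suc q ℕ.^ suc k) ≡ (x ^ (suc q ℕ.^ k)) ^ suc q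
    unfold x = trans (cong (x ^_) (ℕP.*-comm (suc q) (suc q ℕ.^ k))) (sym (ℤP.^-*-assoc x (suc q ℕ.^ k) (suc q)))

-- Power sums modulo a prime p = q + 1: ∑_{a=1}^{p-1} a^e vanishes modulo p
-- unless (p-1) ∣ e, where it is -1.
module PowerSums {q : ℕ} (pr : Prime (suc q)) where

  open import Data.Nat as ℕ using (ℕ; suc; _<_; s≤s; z≤n; _∸_)
  import Data.Nat.Properties as ℕP
  open import Data.Nat.Combinatorics using (_C_; nCn≡1; nCk≡nC[n∸k]; nC1≡n)
  open import Data.Integer using (ℤ; +_; -_; _-_; _+_; _*_; _^_)
  import Data.Integer.Properties as ℤP
  open import Data.Integer.Tactic.RingSolver using (solve-∀)
  open import Relation.Binary.PropositionalEquality
  open import Relation.Binary using (tri<; tri≈; tri>)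
  open import Data.Empty using (⊥-elim)
  open Congruence
  open FiniteSum
  open Binomial

  p = suc q

  powerSum : ℕ → ℤ
  powerSum m = ∑ p (λ n → (+ n) ^ m)

  successive-difference : ∀ m n → (+ suc n) ^ suc m - (+ n) ^ suc m ≡ ∑ (suc m) (λ j → + (suc m C j) * (+ n) ^ j)
  successive-difference m n = begin
    (+ suc n) ^ suc m - (+ n) ^ suc m                      ≡⟨ cong (λ u → u ^ suc m - (+ n) ^ suc m) (ℤP.pos-+ 1 n) ⟩
    (+ 1 + + n) ^ suc m - (+ n) ^ suc m                    ≡⟨ cong (_- (+ n) ^ suc m) (binomial (+ n) (suc m)) ⟩
    ∑ (suc m) T + + (suc m C suc m) * (+ n) ^ suc m - (+ n) ^ suc m
      ≡⟨ cong (λ u → ∑ (suc m) T + + u * (+ n) ^ suc m - (+ n) ^ suc m) (nCn≡1 (suc m)) ⟩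
    ∑ (suc m) T + + 1 * (+ n) ^ suc m - (+ n) ^ suc m      ≡⟨ cancel-top (∑ (suc m) T) ((+ n) ^ suc m) ⟩
    ∑ (suc m) T                                            ∎
    where open ≡-Reasoning
          T = λ j → + (suc m C j) * (+ n) ^ j
          cancel-top : ∀ a b → a + + 1 * b - b ≡ a
          cancel-top = solve-∀

  -- Summing successive-difference over n < p telescopes to p^(m+1) ≡ 0, so
  -- ∑_{j ≤ m} C(m+1,j) powerSum j ≡ 0; if the lower power sums vanish this
  -- leaves (m+1) powerSum m ≡ 0, and m + 1 is invertible for m + 1 < p.
  powerSum-step : ∀ m → suc m < p → (∀ j → j < m → powerSum j ≅ + 0 [ p ]) → powerSum m ≅ + 0 [ p ]
  powerSum-step m m+1<p lower =
    cancel {c = + suc m} pr (small-≇0 (s≤s z≤n) m+1<p) (≅-trans leading≅0 (≅-reflexive (sym (ℤP.*-zeroʳ (+ suc m)))))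
    where
    g : ℕ → ℤ
    g n = (+ n) ^ suc m
    telescoped : ∑ (suc m) (λ j → + (suc m C j) * powerSum j) ≡ g p - g 0
    telescoped = begin
      ∑ (suc m) (λ j → + (suc m C j) * powerSum j)
        ≡⟨ ∑-cong (suc m) (λ j _ → sym (∑-*l p (+ (suc m C j)) (λ n → (+ n) ^ j))) ⟩
      ∑ (suc m) (λ j → ∑ p (λ n → + (suc m C j) * (+ n) ^ j))
        ≡⟨ ∑-swap p (suc m) (λ n j → + (suc m C j) * (+ n) ^ j) ⟨
      ∑ p (λ n → ∑ (suc m) (λ j → + (suc m C j) * (+ n) ^ j))
        ≡⟨ ∑-cong p (λ n _ → successive-difference m n) ⟨
      ∑ p (λ n → g (suc n) - g n)   ≡⟨ ∑-telescope p g ⟩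
      g p - g 0                     ∎
      where open ≡-Reasoning
    total≅0 : ∑ (suc m) (λ j → + (suc m C j) * powerSum j) ≅ + 0 [ p ]
    total≅0 = ≅-trans (≅-reflexive telescoped)
      (≅-trans (≅-- (≅-trans (≅-reflexive (ℤP.*-comm (+ p) ((+ p) ^ m))) (≅-multiple ((+ p) ^ m)))
                    (≅-reflexive (ℤP.*-zeroˡ ((+ 0) ^ m))))
               (≅-reflexive refl))
    lower≅0 : ∑ m (λ j → + (suc m C j) * powerSum j) ≅ + 0 [ p ]
    lower≅0 = ∑-vanish≅ m (λ j j<m → ≅-trans (≅-*l (+ (suc m C j)) (lower j j<m)) (≅-reflexive (ℤP.*-zeroʳ (+ (suc m C j)))))
    C[m+1,m] : suc m C m ≡ suc m
    C[m+1,m] = trans (nCk≡nC[n∸k] (ℕP.n≤1+n m)) (trans (cong (suc m C_) (ℕP.m+n∸n≡m 1 m)) (nC1≡n (suc m)))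
    leading≅0 : + suc m * powerSum m ≅ + 0 [ p ]
    leading≅0 = ≅-trans (≅-reflexive (trans (sym (ℤP.+-identityˡ _)) (cong (λ u → + 0 + + u * powerSum m) (sym C[m+1,m]))))
                        (≅-trans (≅-+ (≅-sym lower≅0) ≅-refl) total≅0)

  powerSums-below : ∀ m → m < p → ∀ j → j < m → powerSum j ≅ + 0 [ p ]
  powerSums-below (suc m) m+1<p j j<m+1 with ℕP.<-cmp j m
  ... | tri< j<m _ _ = powerSums-below m (ℕP.<⇒≤ m+1<p) j j<m
  ... | tri≈ _ refl _ = powerSum-step j m+1<p (powerSums-below j (ℕP.<⇒≤ m+1<p))
  ... | tri> _ _ j>m = ⊥-elim (ℕP.<⇒≱ j<m+1 j>m)

  ΔpowerSum : ℕ → ℤ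
  ΔpowerSum e = ∑ q (λ i → (+ suc i) ^ e)

  ΔpowerSum-small : ∀ e → 0 < e → e < q → ΔpowerSum e ≅ + 0 [ p ]
  ΔpowerSum-small (suc e) _ e<q = ≅-trans (≅-reflexive drop-zero) (powerSums-below (suc (suc e)) (s≤s e<q) (suc e) ℕP.≤-refl)
    where drop-zero : ΔpowerSum (suc e) ≡ powerSum (suc e)
          drop-zero = sym (trans (∑-first q _) (trans (cong (_+ ΔpowerSum (suc e)) (ℤP.*-zeroˡ ((+ 0) ^ e))) (ℤP.+-identityˡ _)))

  -- For e = p - 1 every term is 1 by Fermat, and p - 1 ≡ -1.
  ΔpowerSum-q : ΔpowerSum q ≅ - (+ 1) [ p ]
  ΔpowerSum-q = ≅-trans (∑-cong≅ q (λ i i<q → fermat-unit pr (suc i) (s≤s z≤n) (s≤s i<q)))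
    (≅-trans (≅-reflexive (trans (∑-const q (+ 1)) (ℤP.*-identityʳ (+ q)))) (≅-from-∣ (q+1 q) (≅0⇒∣ (≅-multiple (+ 1)))))
    where q+1 : ∀ q → + q - - (+ 1) ≡ + 1 * + suc q
          q+1 q = trans (ℤP.+-comm (+ q) (+ 1)) (sym (ℤP.*-identityˡ (+ suc q)))

  -- Exponents q + r reduce to r by Fermat.
  ΔpowerSum-big : ∀ r → 0 < r → r < q → ΔpowerSum (q ℕ.+ r) ≅ + 0 [ p ]
  ΔpowerSum-big r 0<r r<q = ≅-trans
    (∑-cong≅ q (λ i i<q → ≅-trans (≅-reflexive (ℤP.^-distribˡ-+-* (+ suc i) q r))
                                    (≅-trans (≅-*r ((+ suc i) ^ r) (fermat-unit pr (suc i) (s≤s z≤n) (s≤s i<q)))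
                                             (≅-reflexive (ℤP.*-identityˡ _)))))
    (ΔpowerSum-small r 0<r r<q)

  ΔpowerSum≅0 : ∀ e → 0 < e → e < q ℕ.+ q → e ≢ q → ΔpowerSum e ≅ + 0 [ p ]
  ΔpowerSum≅0 e 0<e e<2q e≢q with ℕP.<-cmp e q
  ... | tri< e<q _ _ = ΔpowerSum-small e 0<e e<q
  ... | tri≈ _ e≡q _ = ⊥-elim (e≢q e≡q)
  ... | tri> _ _ e>q = subst (λ u → ΔpowerSum u ≅ + 0 [ p ]) (ℕP.m+[n∸m]≡n (ℕP.<⇒≤ e>q))
        (ΔpowerSum-big (e ∸ q) (ℕP.m<n⇒0<n∸m e>q)
          (ℕP.+-cancelˡ-< q _ _ (subst (_< q ℕ.+ q) (sym (ℕP.m+[n∸m]≡n (ℕP.<⇒≤ e>q))) e<2q)))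

module UnitGroup where

  open import Data.Nat as ℕ using (ℕ; zero; suc; _<_; _≤_; s≤s; z≤n; _∸_; _≡ᵇ_)
  import Data.Nat.Properties as ℕP
  import Data.Nat.Divisibility as ℕD
  open import Data.Nat.DivMod using (_%_; m%n<n)
  open import Data.Integer using (+_; -_; _-_; _+_; _*_; _^_)
  import Data.Integer.Properties as ℤP
  open import Data.Integer.Tactic.RingSolver using (solve-∀)
  open import Relation.Binary.PropositionalEquality
  open import Data.Empty using (⊥-elim)
  open import Data.Sum using (inj₁; inj₂)
  open import Data.Product using (_×_; _,_; proj₁; proj₂)
  open import Data.Bool using (Bool; true; false; if_then_else_; T)
  open import Relation.Nullary using (¬_)
  open import Data.Nat.Primality using (Prime)
  import Data.Integer.Divisibility.Signed as S
  open import Defs using (InΔ; inv; invAux; mulΔ)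
  open Congruence
  open Binomial
  open Powers

  residue-≅⇒≡-≥ : ∀ {p a b} → a < p → b ≤ a → + a ≅ + b [ p ] → a ≡ b
  residue-≅⇒≡-≥ {p} {a} {b} a<p b≤a a≅b = ℕP.≤-antisym (ℕP.m∸n≡0⇒m≤n difference≡0) b≤a
    where
    p∣difference : p ℕD.∣ (a ∸ b)
    p∣difference = S.∣⇒∣ᵤ (subst ((+ p) S.∣_) (trans (ℤP.m-n≡m⊖n a b) (ℤP.⊖-≥ b≤a)) (un a≅b))
    difference≡0 : a ∸ b ≡ 0
    difference≡0 with a ∸ b in eq
    ... | zero = refl
    ... | suc d = ⊥-elim (ℕP.<⇒≱ (subst (_< p) eq (ℕP.≤-<-trans (ℕP.m∸n≤m a b) a<p)) (ℕD.∣⇒≤ (subst (p ℕD.∣_) eq p∣difference)))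

  residue-≅⇒≡ : ∀ {p a b} → a < p → b < p → + a ≅ + b [ p ] → a ≡ b
  residue-≅⇒≡ {p} {a} {b} a<p b<p a≅b with ℕP.≤-total b a
  ... | inj₁ b≤a = residue-≅⇒≡-≥ a<p b≤a a≅b
  ... | inj₂ a≤b = sym (residue-≅⇒≡-≥ b<p a≤b (≅-sym a≅b))

  module Δ {q' : ℕ} (pr : Prime (suc (suc q'))) where
    q = suc q'
    p = suc q

    1∈Δ : InΔ p 1
    1∈Δ = s≤s z≤n , s≤s (s≤s z≤n)

    q≅-1 : + q ≅ - (+ 1) [ p ]
    q≅-1 = ≅-from-∣ (trans (ℤP.+-comm (+ q) (+ 1)) (sym (ℤP.*-identityˡ (+ p)))) (S.divides (+ 1) refl)

    %-≅ : ∀ x → + (x % p) ≅ + x [ p ]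
    %-≅ x = %ℕ-≅ (+ x)

    mulΔ-≅ : ∀ a b → + (mulΔ p a b) ≅ + a * + b [ p ]
    mulΔ-≅ a b = ≅-trans (%-≅ (a ℕ.* b)) (≅-reflexive (ℤP.pos-* a b))

    mulΔ< : ∀ a b → mulΔ p a b < p
    mulΔ< a b = m%n<n (a ℕ.* b) p

    product-≇0 : ∀ {a b} → InΔ p a → InΔ p b → ¬ (+ a * + b ≅ + 0 [ p ])
    product-≇0 {a} {b} (1≤a , a<p) (1≤b , b<p) ab≅0 with euclidℤ {a = + a} {b = + b} pr (≅0⇒∣ ab≅0)
    ... | inj₁ p∣a = small-≇0 1≤a a<p (∣⇒≅0 p∣a)
    ... | inj₂ p∣b = small-≇0 1≤b b<p (∣⇒≅0 p∣b)

    mulΔ-in : ∀ {a b} → InΔ p a → InΔ p b → InΔ p (mulΔ p a b)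
    mulΔ-in {a} {b} a∈Δ b∈Δ with mulΔ p a b in eq
    ... | zero = ⊥-elim (product-≇0 a∈Δ b∈Δ (≅-sym (≅-trans (≅-reflexive (cong +_ (sym eq))) (mulΔ-≅ a b))))
    ... | suc r = s≤s z≤n , subst (_< p) eq (mulΔ< a b)

    -- Defs.inv searches downwards from p - 1 for an inverse; it succeeds
    -- whenever some inverse exists in the searched range.
    IsInverse : ℕ → ℕ → Set
    IsInverse a r = 1 ≤ r × ((a ℕ.* r) % p ≡ 1)

    invAux-finds : ∀ a b c → IsInverse a c → c ≤ b → IsInverse a (invAux p a b) × invAux p a b ≤ b
    invAux-finds a zero c (1≤c , _) c≤0 = ⊥-elim (ℕP.<⇒≱ 1≤c c≤0)
    invAux-finds a (suc b) c c-inv c≤b+1 = test ((a ℕ.* suc b) % p ≡ᵇ 1) refl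
      where
      test : (t : Bool) → t ≡ ((a ℕ.* suc b) % p ≡ᵇ 1) →
             IsInverse a (if t then suc b else invAux p a b) × (if t then suc b else invAux p a b) ≤ suc b
      test true eq = (s≤s z≤n , ℕP.≡ᵇ⇒≡ _ 1 (subst T eq _)) , ℕP.≤-refl
      test false eq with ℕP.m≤n⇒m<n∨m≡n c≤b+1
      ... | inj₁ (s≤s c≤b) = let found = invAux-finds a b c c-inv c≤b in proj₁ found , ℕP.m≤n⇒m≤1+n (proj₂ found)
      ... | inj₂ refl = ⊥-elim (subst T (sym eq) (ℕP.≡⇒≡ᵇ _ 1 (proj₂ c-inv)))

    -- By Fermat, a^(p-2) mod p is an inverse of a in the searched range.
    fermat-inverse : ∀ a → InΔ p a → IsInverse a ((a ℕ.^ q') % p) × ((a ℕ.^ q') % p) ≤ q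
    fermat-inverse a (1≤a , a<p) = (positive c is-inverse , is-inverse) , ℕP.≤-pred (m%n<n (a ℕ.^ q') p)
      where
      c = (a ℕ.^ q') % p
      ac≅1 : + (a ℕ.* c) ≅ + 1 [ p ]
      ac≅1 = ≅-trans (≅-reflexive (ℤP.pos-* a c))
                     (≅-trans (≅-*l (+ a) (≅-trans (%-≅ (a ℕ.^ q')) (≅-reflexive (pos-^ a q')))) (fermat-unit pr a 1≤a a<p))
      is-inverse : (a ℕ.* c) % p ≡ 1
      is-inverse = residue-≅⇒≡ (m%n<n (a ℕ.* c) p) (s≤s (s≤s z≤n)) (≅-trans (%-≅ (a ℕ.* c)) ac≅1)
      positive : ∀ c → (a ℕ.* c) % p ≡ 1 → 1 ≤ c
      positive zero e = ⊥-elim (ℕP.0≢1+n (trans (sym (cong (_% p) (ℕP.*-zeroʳ a))) e))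
      positive (suc _) _ = s≤s z≤n

    inv-spec : ∀ a → InΔ p a → IsInverse a (inv p a) × inv p a ≤ q
    inv-spec a a∈Δ = let (c-inv , c≤q) = fermat-inverse a a∈Δ in invAux-finds a q _ c-inv c≤q

    inv-in : ∀ a → InΔ p a → InΔ p (inv p a)
    inv-in a a∈Δ = proj₁ (proj₁ (inv-spec a a∈Δ)) , s≤s (proj₂ (inv-spec a a∈Δ))

    inv-≅ : ∀ a → InΔ p a → + a * + inv p a ≅ + 1 [ p ]
    inv-≅ a a∈Δ = ≅-trans (≅-reflexive (sym (ℤP.pos-* a (inv p a))))
                          (≅-trans (≅-sym (%-≅ (a ℕ.* inv p a))) (≅-reflexive (cong +_ (proj₂ (proj₁ (inv-spec a a∈Δ))))))

    inv-unique : ∀ a x → InΔ p a → x < p → + a * + x ≅ + 1 [ p ] → x ≡ inv p a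
    inv-unique a x a∈Δ x<p ax≅1 = residue-≅⇒≡ x<p (proj₂ (inv-in a a∈Δ))
      (≅-trans x≅x[aa⁻¹] (≅-trans (≅-reflexive (reassoc (+ x) (+ a) (+ inv p a)))
                                 (≅-trans (≅-*r (+ inv p a) ax≅1) (≅-reflexive (ℤP.*-identityˡ _)))))
      where
      x≅x[aa⁻¹] : + x ≅ + x * (+ a * + inv p a) [ p ]
      x≅x[aa⁻¹] = ≅-trans (≅-reflexive (sym (ℤP.*-identityʳ (+ x)))) (≅-*l (+ x) (≅-sym (inv-≅ a a∈Δ)))
      reassoc : ∀ x a i → x * (a * i) ≡ a * x * i
      reassoc = solve-∀

    -- For c, b ∈ Δ the equation c · a⁻¹ = b has the unique solution a = c · b⁻¹;
    -- this reindexes the convolution sums of the group ring.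
    module Quotient {c b} (c∈Δ : InΔ p c) (b∈Δ : InΔ p b) where
      c/b = mulΔ p c (inv p b)

      c/b-in : InΔ p c/b
      c/b-in = mulΔ-in c∈Δ (inv-in b b∈Δ)

      inv-c/b : inv p c/b ≡ mulΔ p b (inv p c)
      inv-c/b = sym (inv-unique c/b (mulΔ p b (inv p c)) c/b-in (mulΔ< b (inv p c))
        (≅-trans (≅-* (mulΔ-≅ c (inv p b)) (mulΔ-≅ b (inv p c)))
          (≅-trans (≅-reflexive (regroup (+ c) (+ inv p b) (+ b) (+ inv p c)))
            (≅-trans (≅-* (inv-≅ c c∈Δ) (inv-≅ b b∈Δ)) (≅-reflexive refl)))))
        where regroup : ∀ c ib b ic → c * ib * (b * ic) ≡ (c * ic) * (b * ib)
              regroup = solve-∀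

      c/b-solves : mulΔ p c (inv p c/b) ≡ b
      c/b-solves = residue-≅⇒≡ (mulΔ< c (inv p c/b)) (proj₂ b∈Δ)
        (≅-trans (mulΔ-≅ c (inv p c/b)) (≅-trans (≅-reflexive (cong (λ u → + c * + u) inv-c/b))
          (≅-trans (≅-*l (+ c) (mulΔ-≅ b (inv p c))) (≅-trans (≅-reflexive (regroup (+ c) (+ b) (+ inv p c)))
            (≅-trans (≅-*r (+ b) (inv-≅ c c∈Δ)) (≅-reflexive (ℤP.*-identityˡ (+ b))))))))
        where regroup : ∀ c b ic → c * (b * ic) ≡ (c * ic) * b
              regroup = solve-∀

      c/b-unique : ∀ a → InΔ p a → mulΔ p c (inv p a) ≡ b → a ≡ c/b
      c/b-unique a a∈Δ solves = residue-≅⇒≡ (proj₂ a∈Δ) (proj₂ c/b-in) (≅-trans a≅c/b (≅-sym (mulΔ-≅ c (inv p b))))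
        where
        b≅c/a : + b ≅ + c * + inv p a [ p ]
        b≅c/a = ≅-trans (≅-reflexive (cong +_ (sym solves))) (mulΔ-≅ c (inv p a))
        a≅c/b : + a ≅ + c * + inv p b [ p ]
        a≅c/b = ≅-trans (≅-reflexive (sym (ℤP.*-identityʳ (+ a))))
                (≅-trans (≅-*l (+ a) (≅-sym (inv-≅ b b∈Δ)))
                (≅-trans (≅-*l (+ a) (≅-*r (+ inv p b) b≅c/a))
                (≅-trans (≅-reflexive (regroup (+ a) (+ c) (+ inv p a) (+ inv p b)))
                (≅-trans (≅-*r (+ c * + inv p b) (inv-≅ a a∈Δ)) (≅-reflexive (ℤP.*-identityˡ _))))))
          where regroup : ∀ a c ia ib → a * (c * ia * ib) ≡ (a * ia) * (c * ib)
                regroup = solve-∀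

module GroupRing where

  open import Data.Nat as ℕ using (ℕ; suc; _<_; _≤_; s≤s; z≤n; _∸_; _≡ᵇ_)
  import Data.Nat.Properties as ℕP
  open import Data.Integer using (ℤ; +_; -_; _-_; _+_; _*_)
  import Data.Integer.Properties as ℤP
  open import Data.Integer.Tactic.RingSolver using (solve-∀)
  open import Relation.Binary.PropositionalEquality
  open import Data.Empty using (⊥-elim)
  open import Data.Product using (_,_; proj₁; proj₂)
  open import Data.Bool using (true; false; T)
  open import Data.Nat.Primality using (Prime)
  open import Defs
  open Congruence
  open FiniteSum
  open UnitGroup

  suc-∸1 : ∀ {x} → 1 ≤ x → suc (x ∸ 1) ≡ x
  suc-∸1 (s≤s _) = refl

  σ-same : ∀ b k → σ b b k ≡ + 1
  σ-same b k with b ≡ᵇ b in eq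
  ... | true = refl
  ... | false = ⊥-elim (subst T eq (ℕP.≡⇒≡ᵇ b b refl))

  σ-diff : ∀ b d k → d ≢ b → σ b d k ≡ + 0
  σ-diff b d k d≢b with d ≡ᵇ b in eq
  ... | true = ⊥-elim (d≢b (ℕP.≡ᵇ⇒≡ d b (subst T (sym eq) _)))
  ... | false = refl

  sψ : (q' : ℕ) → (ℕ → Seq) → Seq
  sψ q' ψ k = sumℤ q' (λ n → + inv (suc (suc q')) n * (ψ 1 k + ψ n k - ψ (suc n) k))

  sψ-Zp : ∀ q' ψ → (∀ a → InΔ (suc (suc q')) a → IsZp (suc (suc q')) (ψ a)) → IsZp (suc (suc q')) (sψ q' ψ)
  sψ-Zp q' ψ ψ-Zp k = toU (≅-trans (≅-reflexive (sumℤ≡∑ q' _))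
    (≅-trans (∑-cong≅ q' (λ j j<q' → ≅-*l (+ inv (suc (suc q')) (suc j))
               (≅-- (≅-+ (step 1 (s≤s z≤n , s≤s (s≤s z≤n))) (step (suc j) (s≤s z≤n , s≤s (s≤s (ℕP.<⇒≤ j<q')))))
                    (step (suc (suc j)) (s≤s z≤n , s≤s (s≤s j<q'))))))
             (≅-reflexive (sym (sumℤ≡∑ q' _)))))
    where step : ∀ a → InΔ (suc (suc q')) a → ψ a (suc k) ≅ ψ a k [ suc (suc q') ℕ.^ k ]
          step a a∈Δ = fromU (ψ-Zp a a∈Δ k)

  -- For a multiplicative ψ : Δ → ℤ_p the idempotent e_ψ absorbs group elements,
  -- e_ψ σ_b = ψ(b) e_ψ; hence e_ψ s = s_ψ e_ψ.
  module Convolution {q' : ℕ} (pr : Prime (suc (suc q'))) (ψ : ℕ → Seq)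
    (ψ-mult : ∀ a b → InΔ (suc (suc q')) a → InΔ (suc (suc q')) b →
              ψ (mulΔ (suc (suc q')) a b) ≈[ suc (suc q') ] (ψ a ⊗ ψ b)) where
    open Δ pr

    module AtLevel (k : ℕ) {c : ℕ} (c∈Δ : InΔ p c) where
      M = p ℕ.^ k
      Ψ : ℕ → ℤ
      Ψ x = ψ x k
      E = invPm1 p k * Ψ (inv p c)
      X : ℕ → ℤ
      X a = invPm1 p k * Ψ (inv p a)
      d : ℕ → ℕ
      d a = mulΔ p c (inv p a)
      -- the coefficient of σ_c in e_ψ σ_b
      eσ : ℕ → ℤ
      eσ b = ∑ q (λ i → X (suc i) * σ b (d (suc i)) k)

      -- Only a = c b⁻¹ contributes, so e_ψ σ_b = ψ(b) e_ψ at σ_c.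
      eσ≅ : ∀ b → InΔ p b → eσ b ≅ Ψ b * E [ M ]
      eσ≅ b b∈Δ = ≅-trans (∑-single≅ q (c/b ∸ 1) (λ i → X (suc i) * σ b (d (suc i)) k) index<q others-vanish)
                  (≅-trans (≅-reflexive at-c/b)
                  (≅-trans (≅-*l (invPm1 p k) (fromU (ψ-mult b (inv p c) b∈Δ (inv-in c c∈Δ) k)))
                           (≅-reflexive (reorder (invPm1 p k) (Ψ b) (Ψ (inv p c))))))
        where
        open Quotient c∈Δ b∈Δ
        index<q : c/b ∸ 1 < q
        index<q = ℕP.≤-pred (subst (_< p) (sym (suc-∸1 (proj₁ c/b-in))) (proj₂ c/b-in))
        others-vanish : ∀ i → i < q → i ≢ c/b ∸ 1 → X (suc i) * σ b (d (suc i)) k ≅ + 0 [ M ]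
        others-vanish i i<q i≢ = ≅-reflexive (trans (cong (X (suc i) *_) (σ-diff b (d (suc i)) k
           (λ solves → i≢ (cong (_∸ 1) (c/b-unique (suc i) (s≤s z≤n , s≤s i<q) solves))))) (ℤP.*-zeroʳ (X (suc i))))
        at-c/b : X (suc (c/b ∸ 1)) * σ b (d (suc (c/b ∸ 1))) k ≡ invPm1 p k * ψ (mulΔ p b (inv p c)) k
        at-c/b = begin
          X (suc (c/b ∸ 1)) * σ b (d (suc (c/b ∸ 1))) k ≡⟨ cong (λ u → X u * σ b (d u) k) (suc-∸1 (proj₁ c/b-in)) ⟩
          X c/b * σ b (d c/b) k                         ≡⟨ cong (λ u → X c/b * σ b u k) c/b-solves ⟩
          X c/b * σ b b k                               ≡⟨ cong (X c/b *_) (σ-same b k) ⟩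
          X c/b * + 1                                   ≡⟨ ℤP.*-identityʳ (X c/b) ⟩
          invPm1 p k * Ψ (inv p c/b)                    ≡⟨ cong (λ u → invPm1 p k * Ψ u) inv-c/b ⟩
          invPm1 p k * ψ (mulΔ p b (inv p c)) k         ∎
          where open ≡-Reasoning
        reorder : ∀ I a b → I * (a * b) ≡ a * (I * b)
        reorder = solve-∀

      w : ℕ → ℤ
      w j = + inv p (suc j)
      A : ℕ → ℕ → ℤ
      A j a = (σ 1 (d a) k + σ (suc j) (d a) k) - σ (suc (suc j)) (d a) k

      summand : ∀ j → ∑ q (λ i → X (suc i) * (w j * A j (suc i))) ≡ w j * (eσ 1 + eσ (suc j) - eσ (suc (suc j)))
      summand j = begin
        ∑ q (λ i → X (suc i) * (w j * A j (suc i)))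
          ≡⟨ ∑-cong q (λ i _ → distribute (X (suc i)) (w j) (σ 1 (d (suc i)) k) (σ (suc j) (d (suc i)) k) (σ (suc (suc j)) (d (suc i)) k)) ⟩
        ∑ q (λ i → w j * ((X (suc i) * σ 1 (d (suc i)) k + X (suc i) * σ (suc j) (d (suc i)) k) - X (suc i) * σ (suc (suc j)) (d (suc i)) k))
          ≡⟨ ∑-*l q (w j) _ ⟩
        w j * ∑ q (λ i → (X (suc i) * σ 1 (d (suc i)) k + X (suc i) * σ (suc j) (d (suc i)) k) - X (suc i) * σ (suc (suc j)) (d (suc i)) k)
          ≡⟨ cong (w j *_) (trans (∑-- q _ _) (cong (_- eσ (suc (suc j))) (∑-+ q _ _))) ⟩
        w j * (eσ 1 + eσ (suc j) - eσ (suc (suc j))) ∎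
        where open ≡-Reasoning
              distribute : ∀ x w a b c → x * (w * ((a + b) - c)) ≡ w * ((x * a + x * b) - x * c)
              distribute = solve-∀

      convolution-at-c : (e p ψ ⋆[ p ] s p) c k ≅ sψ q' ψ k * E [ M ]
      convolution-at-c = ≅-trans (≅-reflexive by-summands)
        (≅-trans (∑-cong≅ q' (λ j j<q' → ≅-*l (w j) (≅-- (≅-+ (eσ≅ 1 (s≤s z≤n , s≤s (s≤s z≤n)))
                                                                (eσ≅ (suc j) (s≤s z≤n , s≤s (s≤s (ℕP.<⇒≤ j<q')))))
                                                           (eσ≅ (suc (suc j)) (s≤s z≤n , s≤s (s≤s j<q'))))))
                 (≅-reflexive factor-E))
        where
        open ≡-Reasoning
        by-summands : (e p ψ ⋆[ p ] s p) c k ≡ ∑ q' (λ j → w j * (eσ 1 + eσ (suc j) - eσ (suc (suc j))))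
        by-summands = begin
          sumℤ q (λ a → X a * sumℤ q' (λ n → + inv p n * ((σ 1 (d a) k + σ n (d a) k) - σ (suc n) (d a) k)))
            ≡⟨ sumℤ≡∑ q _ ⟩
          ∑ q (λ i → X (suc i) * sumℤ q' (λ n → + inv p n * ((σ 1 (d (suc i)) k + σ n (d (suc i)) k) - σ (suc n) (d (suc i)) k)))
            ≡⟨ ∑-cong q (λ i _ → cong (X (suc i) *_) (sumℤ≡∑ q' _)) ⟩
          ∑ q (λ i → X (suc i) * ∑ q' (λ j → w j * A j (suc i)))  ≡⟨ ∑-cong q (λ i _ → sym (∑-*l q' (X (suc i)) _)) ⟩
          ∑ q (λ i → ∑ q' (λ j → X (suc i) * (w j * A j (suc i)))) ≡⟨ ∑-swap q q' _ ⟩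
          ∑ q' (λ j → ∑ q (λ i → X (suc i) * (w j * A j (suc i)))) ≡⟨ ∑-cong q' (λ j _ → summand j) ⟩
          ∑ q' (λ j → w j * (eσ 1 + eσ (suc j) - eσ (suc (suc j)))) ∎
        factor-E : ∑ q' (λ j → w j * (Ψ 1 * E + Ψ (suc j) * E - Ψ (suc (suc j)) * E)) ≡ sψ q' ψ k * E
        factor-E = begin
          ∑ q' (λ j → w j * (Ψ 1 * E + Ψ (suc j) * E - Ψ (suc (suc j)) * E))
            ≡⟨ ∑-cong q' (λ j _ → collect (w j) (Ψ 1) (Ψ (suc j)) (Ψ (suc (suc j))) E) ⟩
          ∑ q' (λ j → w j * (Ψ 1 + Ψ (suc j) - Ψ (suc (suc j))) * E) ≡⟨ ∑-*r q' E _ ⟩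
          ∑ q' (λ j → w j * (Ψ 1 + Ψ (suc j) - Ψ (suc (suc j)))) * E ≡⟨ cong (_* E) (sym (sumℤ≡∑ q' _)) ⟩
          sψ q' ψ k * E ∎
          where collect : ∀ w a b c E → w * (a * E + b * E - c * E) ≡ w * (a + b - c) * E
                collect = solve-∀

    eψ⋆s≅ : ∀ c → InΔ p c → ∀ k → (e p ψ ⋆[ p ] s p) c k ≅ (sψ q' ψ · e p ψ) c k [ p ℕ.^ k ]
    eψ⋆s≅ c c∈Δ k = AtLevel.convolution-at-c k c∈Δ

-- Characters of Δ modulo p are powers of the identity.
module CharactersModP where

  open import Data.Nat as ℕ using (ℕ; zero; suc; _<_; s≤s; z≤n; _∸_)
  import Data.Nat.Properties as ℕP
  open import Data.Integer using (ℤ; +_; -_; _-_; _+_; _*_; _^_)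
  import Data.Integer.Properties as ℤP
  open import Data.Integer.Tactic.RingSolver using (solve-∀)
  open import Relation.Binary.PropositionalEquality
  open import Data.Empty using (⊥-elim)
  open import Data.Sum using (_⊎_; inj₁; inj₂)
  open import Data.Product using (Σ; _×_; _,_; proj₁; proj₂)
  open import Relation.Nullary using (yes; no; ¬_)
  open import Data.Nat.Primality using (Prime)
  open import Defs using (InΔ; mulΔ)
  open Congruence
  open FiniteSum
  open Binomial
  open Powers
  open UnitGroup
  open GroupRing using (suc-∸1)

  first-nonvanishing : ∀ (f : ℕ → ℤ) m n → (∀ j → j < n → f j ≅ + 0 [ m ]) ⊎ Σ ℕ (λ j → j < n × ¬ (f j ≅ + 0 [ m ]))
  first-nonvanishing f m zero = inj₁ (λ j ())
  first-nonvanishing f m (suc n) with first-nonvanishing f m n | ≅0? (f n) m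
  ... | inj₂ (j , j<n , f≇0) | _ = inj₂ (j , ℕP.m<n⇒m<1+n j<n , f≇0)
  ... | inj₁ _ | no f≇0 = inj₂ (n , ℕP.≤-refl , f≇0)
  ... | inj₁ below | yes fn≅0 = inj₁ extend
    where
    extend : ∀ j → j < suc n → f j ≅ + 0 [ m ]
    extend j j<n+1 with ℕP.m≤n⇒m<n∨m≡n (ℕP.≤-pred j<n+1)
    ... | inj₁ j<n = below j j<n
    ... | inj₂ refl = fn≅0

  -- Proof by Lagrange interpolation on Δ: -χ(y) ≡ ∑_{j<q} c_j y^j for explicit c_j,
  -- and a polynomial of degree < p - 1 vanishing on Δ has vanishing coefficients.
  module Characters {q' : ℕ} (pr : Prime (suc (suc q'))) (χ : ℕ → ℤ)
    (χ-mult : ∀ a b → InΔ (suc (suc q')) a → InΔ (suc (suc q')) b →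
              χ (mulΔ (suc (suc q')) a b) ≅ χ a * χ b [ suc (suc q') ])
    (χ≇0 : ∀ a → InΔ (suc (suc q')) a → ¬ (χ a ≅ + 0 [ suc (suc q') ])) where
    open Δ pr
    open PowerSums pr using (ΔpowerSum; ΔpowerSum≅0; ΔpowerSum-q)

    -- x · (x^q - y^q)/(x - y) is the Lagrange kernel of Δ: -1 on the diagonal, 0 off it.
    kernel-diag : ∀ x → InΔ p x → + x * geom q (+ x) (+ x) ≅ - (+ 1) [ p ]
    kernel-diag x (1≤x , x<p) =
      ≅-trans (≅-reflexive (trans (cong (+ x *_) (geom-diag q' (+ x))) (reorder (+ x) (+ q) ((+ x) ^ q'))))
              (≅-trans (≅-*r (+ q) (fermat-unit pr x 1≤x x<p)) (≅-trans (≅-reflexive (ℤP.*-identityˡ (+ q))) q≅-1))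
      where reorder : ∀ x n X → x * (n * X) ≡ x * X * n
            reorder = solve-∀

    kernel-off : ∀ x y → InΔ p x → InΔ p y → x ≢ y → + x * geom q (+ x) (+ y) ≅ + 0 [ p ]
    kernel-off x y (1≤x , x<p) (1≤y , y<p) x≢y = ≅-trans (≅-*l (+ x) geom≅0) (≅-reflexive (ℤP.*-zeroʳ (+ x)))
      where
      x-y≇0 : ¬ (+ x - + y ≅ + 0 [ p ])
      x-y≇0 d = x≢y (residue-≅⇒≡ x<p y<p (diff≅0⇒≅ d))
      geom≅0 : geom q (+ x) (+ y) ≅ + 0 [ p ]
      geom≅0 = cancel pr x-y≇0 (≅-trans (≅-reflexive (geom-factor q (+ x) (+ y)))
                (≅-trans (≅-- (fermat-unit pr x 1≤x x<p) (fermat-unit pr y 1≤y y<p))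
                         (≅-reflexive (trans (ℤP.+-inverseʳ (+ 1)) (sym (ℤP.*-zeroʳ (+ x - + y)))))))

    c : ℕ → ℤ
    c m = ∑ q (λ i → χ (suc i) * (+ suc i * (+ suc i) ^ (q ∸ suc m)))

    interpolation : ∀ y → InΔ p y → ∑ q (λ j → c j * (+ y) ^ j) ≅ - χ y [ p ]
    interpolation y y∈Δ = ≅-trans (≅-reflexive as-kernel-sum)
       (≅-trans (∑-single≅ q (y ∸ 1) F index<q
                   (λ i i<q i≢ → ≅-trans (≅-*l (χ (suc i)) (kernel-off (suc i) y (s≤s z≤n , s≤s i<q) y∈Δ (λ e → i≢ (cong (_∸ 1) e))))
                                          (≅-reflexive (ℤP.*-zeroʳ (χ (suc i))))))
       (≅-trans (≅-reflexive (cong F' (suc-∸1 (proj₁ y∈Δ))))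
                (≅-trans (≅-*l (χ y) (kernel-diag y y∈Δ)) (≅-reflexive (times-minus-one (χ y))))))
      where
      open ≡-Reasoning
      F' : ℕ → ℤ
      F' x = χ x * (+ x * geom q (+ x) (+ y))
      F : ℕ → ℤ
      F i = F' (suc i)
      index<q : y ∸ 1 < q
      index<q = ℕP.≤-pred (subst (_< p) (sym (suc-∸1 (proj₁ y∈Δ))) (proj₂ y∈Δ))
      times-minus-one : ∀ a → a * - (+ 1) ≡ - a
      times-minus-one = solve-∀
      reassoc : ∀ a b X Y → a * (b * X) * Y ≡ a * (b * (X * Y))
      reassoc = solve-∀
      as-kernel-sum : ∑ q (λ j → c j * (+ y) ^ j) ≡ ∑ q F
      as-kernel-sum = begin
        ∑ q (λ j → c j * (+ y) ^ j) ≡⟨ ∑-cong q (λ j _ → sym (∑-*r q ((+ y) ^ j) _)) ⟩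
        ∑ q (λ j → ∑ q (λ i → χ (suc i) * (+ suc i * (+ suc i) ^ (q ∸ suc j)) * (+ y) ^ j)) ≡⟨ ∑-swap q q _ ⟨
        ∑ q (λ i → ∑ q (λ j → χ (suc i) * (+ suc i * (+ suc i) ^ (q ∸ suc j)) * (+ y) ^ j))
          ≡⟨ ∑-cong q (λ i _ → ∑-cong q (λ j _ → reassoc (χ (suc i)) (+ suc i) _ _)) ⟩
        ∑ q (λ i → ∑ q (λ j → χ (suc i) * (+ suc i * ((+ suc i) ^ (q ∸ suc j) * (+ y) ^ j))))
          ≡⟨ ∑-cong q (λ i _ → trans (∑-*l q (χ (suc i)) _) (cong (χ (suc i) *_) (∑-*l q (+ suc i) _))) ⟩
        ∑ q (λ i → χ (suc i) * (+ suc i * ∑ q (λ j → (+ suc i) ^ (q ∸ suc j) * (+ y) ^ j)))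
          ≡⟨ ∑-cong q (λ i _ → cong (λ u → χ (suc i) * (+ suc i * u)) (sym (geom-∑ q (+ suc i) (+ y)))) ⟩
        ∑ q F ∎

    -- If ∑_{j<q} d_j y^j vanishes on Δ then so does each d_m: multiply by y^(q-m),
    -- sum over y ∈ Δ and use that only the exponent q gives a nonzero power sum.
    coefficients-vanish : (d : ℕ → ℤ) → (∀ y → InΔ p y → ∑ q (λ j → d j * (+ y) ^ j) ≅ + 0 [ p ]) →
                          ∀ m → m < q → d m ≅ + 0 [ p ]
    coefficients-vanish d vanishes m m<q =
      ≅-trans (≅-reflexive (sym (ℤP.neg-involutive (d m)))) (≅-trans (≅-neg -dm≅0) (≅-reflexive refl))
      where
      open ≡-Reasoning
      shifted : ℕ → ℕ
      shifted j = (q ∸ m) ℕ.+ j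
      shifted-m≡q : shifted m ≡ q
      shifted-m≡q = ℕP.m∸n+n≡m (ℕP.<⇒≤ m<q)
      weighted≅0 : ∑ q (λ i → (+ suc i) ^ (q ∸ m) * ∑ q (λ j → d j * (+ suc i) ^ j)) ≅ + 0 [ p ]
      weighted≅0 = ∑-vanish≅ q (λ i i<q → ≅-trans (≅-*l ((+ suc i) ^ (q ∸ m)) (vanishes (suc i) (s≤s z≤n , s≤s i<q)))
                                                  (≅-reflexive (ℤP.*-zeroʳ ((+ suc i) ^ (q ∸ m)))))
      reorder : ∀ X d Y → X * (d * Y) ≡ d * (X * Y)
      reorder = solve-∀
      as-power-sums : ∑ q (λ i → (+ suc i) ^ (q ∸ m) * ∑ q (λ j → d j * (+ suc i) ^ j)) ≡ ∑ q (λ j → d j * ΔpowerSum (shifted j))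
      as-power-sums = begin
        ∑ q (λ i → (+ suc i) ^ (q ∸ m) * ∑ q (λ j → d j * (+ suc i) ^ j))
          ≡⟨ ∑-cong q (λ i _ → sym (∑-*l q ((+ suc i) ^ (q ∸ m)) (λ j → d j * (+ suc i) ^ j))) ⟩
        ∑ q (λ i → ∑ q (λ j → (+ suc i) ^ (q ∸ m) * (d j * (+ suc i) ^ j)))
          ≡⟨ ∑-cong q (λ i _ → ∑-cong q (λ j _ → trans (reorder ((+ suc i) ^ (q ∸ m)) (d j) ((+ suc i) ^ j))
                                                       (cong (d j *_) (sym (ℤP.^-distribˡ-+-* (+ suc i) (q ∸ m) j))))) ⟩
        ∑ q (λ i → ∑ q (λ j → d j * (+ suc i) ^ shifted j)) ≡⟨ ∑-swap q q _ ⟩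
        ∑ q (λ j → ∑ q (λ i → d j * (+ suc i) ^ shifted j)) ≡⟨ ∑-cong q (λ j _ → ∑-*l q (d j) _) ⟩
        ∑ q (λ j → d j * ΔpowerSum (shifted j)) ∎
      others : ∀ j → j < q → j ≢ m → d j * ΔpowerSum (shifted j) ≅ + 0 [ p ]
      others j j<q j≢m = ≅-trans (≅-*l (d j) (ΔpowerSum≅0 (shifted j) (ℕP.<-≤-trans (ℕP.m<n⇒0<n∸m m<q) (ℕP.m≤m+n _ j))
                                    (ℕP.+-mono-≤-< (ℕP.m∸n≤m q m) j<q)
                                    (λ eq → j≢m (ℕP.+-cancelˡ-≡ (q ∸ m) j m (trans eq (sym shifted-m≡q))))))
                                 (≅-reflexive (ℤP.*-zeroʳ (d j)))
      -dm≅0 : - d m ≅ + 0 [ p ]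
      -dm≅0 = ≅-trans (≅-reflexive (sym (times-minus-one (d m))))
              (≅-trans (≅-*l (d m) (≅-sym (subst (λ u → ΔpowerSum u ≅ - (+ 1) [ p ]) (sym shifted-m≡q) ΔpowerSum-q)))
              (≅-trans (≅-sym (∑-single≅ q m _ m<q others)) (≅-trans (≅-reflexive (sym as-power-sums)) weighted≅0)))
        where times-minus-one : ∀ a → a * - (+ 1) ≡ - a
              times-minus-one = solve-∀

    -- Some coefficient survives, since χ(1) ≢ 0.
    some-c≇0 : Σ ℕ (λ m → m < q × ¬ (c m ≅ + 0 [ p ]))
    some-c≇0 with first-nonvanishing c p q
    ... | inj₂ found = found
    ... | inj₁ all≅0 = ⊥-elim (χ≇0 1 1∈Δ (≅-trans (≅-reflexive (sym (ℤP.neg-involutive (χ 1)))) (≅-neg -χ1≅0)))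
      where
      -χ1≅0 : - χ 1 ≅ + 0 [ p ]
      -χ1≅0 = ≅-trans (≅-sym (interpolation 1 1∈Δ))
                      (∑-vanish≅ q (λ j j<q → ≅-trans (≅-*r ((+ 1) ^ j) (all≅0 j j<q)) (≅-reflexive (ℤP.*-zeroˡ ((+ 1) ^ j)))))

    -- By multiplicativity y ↦ ∑_j c_j (b^j - χ(b)) y^j vanishes on Δ, for each b ∈ Δ.
    twisted-vanishes : ∀ b → InΔ p b → ∀ y → InΔ p y → ∑ q (λ j → c j * ((+ b) ^ j - χ b) * (+ y) ^ j) ≅ + 0 [ p ]
    twisted-vanishes b b∈Δ y y∈Δ = ≅-trans (≅-reflexive split) (≅-trans (≅-- at-by at-y) (≅-reflexive (ℤP.+-inverseʳ (χ b * (- χ y)))))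
      where
      open ≡-Reasoning
      distribute : ∀ c B X Y → c * (B - X) * Y ≡ c * (B * Y) - X * (c * Y)
      distribute = solve-∀
      split : ∑ q (λ j → c j * ((+ b) ^ j - χ b) * (+ y) ^ j)
            ≡ ∑ q (λ j → c j * ((+ b) ^ j * (+ y) ^ j)) - χ b * ∑ q (λ j → c j * (+ y) ^ j)
      split = begin
        ∑ q (λ j → c j * ((+ b) ^ j - χ b) * (+ y) ^ j)          ≡⟨ ∑-cong q (λ j _ → distribute (c j) ((+ b) ^ j) (χ b) ((+ y) ^ j)) ⟩
        ∑ q (λ j → c j * ((+ b) ^ j * (+ y) ^ j) - χ b * (c j * (+ y) ^ j))  ≡⟨ ∑-- q _ _ ⟩
        ∑ q (λ j → c j * ((+ b) ^ j * (+ y) ^ j)) - ∑ q (λ j → χ b * (c j * (+ y) ^ j))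
          ≡⟨ cong (λ u → ∑ q (λ j → c j * ((+ b) ^ j * (+ y) ^ j)) - u) (∑-*l q (χ b) _) ⟩
        ∑ q (λ j → c j * ((+ b) ^ j * (+ y) ^ j)) - χ b * ∑ q (λ j → c j * (+ y) ^ j) ∎
      at-by : ∑ q (λ j → c j * ((+ b) ^ j * (+ y) ^ j)) ≅ χ b * (- χ y) [ p ]
      at-by = ≅-trans (∑-cong≅ q (λ j _ → ≅-*l (c j) (≅-trans (≅-reflexive (sym (^-distribʳ-* (+ b) (+ y) j)))
                                                               (≅-^ (≅-sym (mulΔ-≅ b y)) j))))
              (≅-trans (interpolation (mulΔ p b y) (mulΔ-in b∈Δ y∈Δ))
                       (≅-trans (≅-neg (χ-mult b y b∈Δ y∈Δ)) (≅-reflexive (ℤP.neg-distribʳ-* (χ b) (χ y)))))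
      at-y : χ b * ∑ q (λ j → c j * (+ y) ^ j) ≅ χ b * (- χ y) [ p ]
      at-y = ≅-*l (χ b) (interpolation y y∈Δ)

    -- χ(b) ≡ b^m for an m with c_m ≢ 0: cancel c_m in c_m (b^m - χ(b)) ≡ 0.
    character-is-power : Σ ℕ (λ m → m < q × (∀ b → InΔ p b → χ b ≅ (+ b) ^ m [ p ]))
    character-is-power with some-c≇0
    ... | m , m<q , cm≇0 = m , m<q , λ b b∈Δ →
          ≅-sym (cancel pr cm≇0 (diff≅0⇒≅ (≅-trans (≅-reflexive (factor (c m) ((+ b) ^ m) (χ b)))
                                                 (coefficients-vanish (λ j → c j * ((+ b) ^ j - χ b)) (twisted-vanishes b b∈Δ) m m<q))))
      where factor : ∀ c x y → c * x - c * y ≡ c * (x - y)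
            factor = solve-∀

module TwistedSums where

  open import Data.Nat using (ℕ; zero; suc; _<_; _≤_; s≤s; z≤n)
  import Data.Nat.Properties as ℕP
  open import Data.Integer using (ℤ; +_; -_; _-_; _+_; _*_; _^_)
  import Data.Integer.Properties as ℤP
  open import Data.Integer.Tactic.RingSolver using (solve-∀)
  open import Relation.Binary.PropositionalEquality
  open import Data.Sum using (_⊎_; inj₁; inj₂)
  open import Data.Product using (_,_)
  open import Data.Nat.Primality using (Prime)
  open import Defs using (Seq; InΔ; inv)
  open Congruence
  open FiniteSum
  open UnitGroup
  open GroupRing using (sψ)

  neg1 : ℤ
  neg1 = - (+ 1)

  neg1-power : ∀ m → neg1 ^ m ≡ + 1 ⊎ neg1 ^ m ≡ neg1
  neg1-power zero = inj₁ refl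
  neg1-power (suc m) with neg1-power m
  ... | inj₁ even = inj₂ (cong (neg1 *_) even)
  ... | inj₂ odd = inj₁ (cong (neg1 *_) odd)

  -- δ i x = (1 + x)^i - x^i - 1, the term of s after substituting the character b ↦ b^i.
  δ : ℕ → ℤ → ℤ
  δ i x = ((+ 1 + x) ^ i - x ^ i) - + 1

  module Twisted {q' : ℕ} (pr : Prime (suc (suc q'))) where
    open Δ pr
    open PowerSums pr using (ΔpowerSum-small)

    recip : ℕ → ℤ
    recip j = + inv p (suc j)

    A : ℕ → ℤ
    A i = ∑ q' (λ j → recip j * δ i (+ suc j))

    T : ℕ → ℤ
    T i = ∑ q' (λ j → δ i (+ suc j))

    S : ℕ → ℤ
    S e = ∑ q' (λ j → (+ suc j) ^ e)

    -- n⁻¹ δ_{i+2}(n) = n⁻¹ δ_{i+1}(n) + n·n⁻¹ (δ_{i+1}(n) + n^i + 1).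
    A-step : ∀ i → A (suc (suc i)) ≅ A (suc i) + (T (suc i) + S i + + q') [ p ]
    A-step i = ≅-trans (∑-cong≅ q' (λ j j<q' →
        ≅-trans (≅-reflexive (expand (recip j) (+ suc j) ((+ 1 + + suc j) ^ suc i) ((+ suc j) ^ i)))
                (≅-+ (≅-refl {recip j * δ (suc i) (+ suc j)})
                     (≅-trans (≅-*r _ (inv-≅ (suc j) (s≤s z≤n , s≤s (s≤s (ℕP.<⇒≤ j<q'))))) (≅-reflexive (ℤP.*-identityˡ _))))))
      (≅-reflexive collect)
      where
      open ≡-Reasoning
      expand : ∀ r x P X → r * (((+ 1 + x) * P - x * (x * X)) - + 1)
                         ≡ r * ((P - x * X) - + 1) + (x * r) * (((P - x * X) - + 1) + X + + 1)
      expand = solve-∀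
      collect : ∑ q' (λ j → recip j * δ (suc i) (+ suc j) + (δ (suc i) (+ suc j) + (+ suc j) ^ i + + 1))
              ≡ A (suc i) + (T (suc i) + S i + + q')
      collect = begin
        ∑ q' (λ j → recip j * δ (suc i) (+ suc j) + (δ (suc i) (+ suc j) + (+ suc j) ^ i + + 1)) ≡⟨ ∑-+ q' _ _ ⟩
        A (suc i) + ∑ q' (λ j → δ (suc i) (+ suc j) + (+ suc j) ^ i + + 1)
          ≡⟨ cong (λ u → A (suc i) + u) (trans (∑-+ q' _ _) (cong₂ _+_ (∑-+ q' _ _) (trans (∑-const q' (+ 1)) (ℤP.*-identityʳ (+ q'))))) ⟩
        A (suc i) + (T (suc i) + S i + + q') ∎

    A1≡0 : A 1 ≡ + 0
    A1≡0 = trans (∑-cong q' (λ j _ → trans (cong (recip j *_) (δ1≡0 (+ suc j))) (ℤP.*-zeroʳ (recip j)))) (∑-zero q')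
      where δ1≡0 : ∀ x → ((+ 1 + x) * + 1 - x * + 1) - + 1 ≡ + 0
            δ1≡0 = solve-∀

    -- T telescopes.
    T-closed : ∀ i → T i ≡ ((+ q) ^ i - + 1) - + q'
    T-closed i = begin
      T i ≡⟨ ∑-cong q' (λ j _ → cong (λ u → ((u ^ i - (+ suc j) ^ i) - + 1)) (sym (ℤP.pos-+ 1 (suc j)))) ⟩
      ∑ q' (λ j → ((+ suc (suc j)) ^ i - (+ suc j) ^ i) - + 1)                  ≡⟨ ∑-- q' _ _ ⟩
      ∑ q' (λ j → (+ suc (suc j)) ^ i - (+ suc j) ^ i) - ∑ q' (λ _ → + 1)
        ≡⟨ cong₂ _-_ (trans (∑-telescope q' (λ j → (+ suc j) ^ i)) (cong (λ u → (+ q) ^ i - u) (ℤP.^-zeroˡ i)))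
                     (trans (∑-const q' (+ 1)) (ℤP.*-identityʳ (+ q'))) ⟩
      ((+ q) ^ i - + 1) - + q' ∎
      where open ≡-Reasoning

    q'≅-2 : + q' ≅ - (+ 2) [ p ]
    q'≅-2 = ≅-from-∣ (trans (shift (+ q')) (cong (λ u → + 1 * u) (sym (ℤP.pos-+ 2 q')))) (≅0⇒∣ (≅-multiple (+ 1)))
      where shift : ∀ x → x - - (+ 2) ≡ + 1 * (+ 2 + x)
            shift = solve-∀

    -- S e misses only the term (p-1)^e ≡ (-1)^e of the vanishing power sum.
    S-small≅ : ∀ e → 0 < e → e < q → S e ≅ - (neg1 ^ e) [ p ]
    S-small≅ e 0<e e<q = ≅-trans (≅-reflexive (add-sub (S e) ((+ q) ^ e)))
      (≅-trans (≅-- (≅-refl {S e + (+ q) ^ e}) (≅-^ q≅-1 e))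
               (≅-trans (≅-- (ΔpowerSum-small e 0<e e<q) (≅-refl {neg1 ^ e})) (≅-reflexive (ℤP.+-identityˡ _))))
      where add-sub : ∀ a b → a ≡ a + b - b
            add-sub = solve-∀

    A2≅ : A 2 ≅ - (+ 4) [ p ]
    A2≅ = ≅-trans (A-step 0) (≅-trans (≅-reflexive (cong₂ (λ u v → u + (v + S 0 + + q')) A1≡0 (T-closed 1)))
           (≅-trans (≅-reflexive (trans (cong (λ u → + 0 + ((((+ q) ^ 1 - + 1) - + q') + u + + q')) (trans (∑-const q' (+ 1)) (ℤP.*-identityʳ (+ q'))))
                                        (simplify q')))
                    (≅-+ q'≅-2 q'≅-2)))
      where simplify : ∀ q' → + 0 + ((((+ suc q') ^ 1 - + 1) - + q') + + q' + + q') ≡ + q' + + q'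
            simplify q' = trans (cong (λ u → + 0 + ((((u - + 1) - + q') + + q' + + q')))
                                      (trans (ℤP.*-identityʳ (+ suc q')) (ℤP.pos-+ 1 q')))
                                (ring (+ q'))
              where ring : ∀ x → + 0 + ((((+ 1 + x - + 1) - x) + x + x)) ≡ x + x
                    ring = solve-∀

    A-closed : ∀ t → suc (suc t) ≤ q → A (suc (suc t)) ≅ (- (+ suc (suc t)) - + 1) - neg1 ^ suc (suc t) [ p ]
    A-closed zero _ = A2≅
    A-closed (suc t) t+3≤q =
      ≅-trans (A-step (suc t))
              (≅-trans (≅-+ (A-closed t (ℕP.≤-pred (ℕP.m≤n⇒m≤1+n t+3≤q)))
                            (≅-+ (≅-+ T≅ (S-small≅ (suc t) (s≤s z≤n) (ℕP.≤-trans (s≤s (ℕP.n≤1+n (suc t))) t+3≤q))) q'≅-2))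
                       (≅-reflexive combine))
      where
      T≅ : T (suc (suc t)) ≅ (neg1 ^ suc (suc t) - + 1) - - (+ 2) [ p ]
      T≅ = ≅-trans (≅-reflexive (T-closed (suc (suc t)))) (≅-- (≅-- (≅-^ q≅-1 (suc (suc t))) (≅-refl {+ 1})) q'≅-2)
      combine : ((- (+ suc (suc t)) - + 1) - neg1 ^ suc (suc t)) + (((neg1 ^ suc (suc t) - + 1) - - (+ 2)) + - (neg1 ^ suc t) + - (+ 2))
              ≡ (- (+ suc (suc (suc t))) - + 1) - neg1 ^ suc (suc (suc t))
      combine = trans (cong (λ u → ((- u - + 1) - neg1 ^ suc (suc t)) + (((neg1 ^ suc (suc t) - + 1) - - (+ 2)) + - (neg1 ^ suc t) + - (+ 2)))
                            (ℤP.pos-+ 2 t))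
                (trans (ring (+ t) (neg1 ^ t)) (cong (λ u → (- u - + 1) - neg1 ^ suc (suc (suc t))) (sym (ℤP.pos-+ 3 t))))
        where ring : ∀ t X → ((- (+ 2 + t) - + 1) - neg1 * (neg1 * X)) + (((neg1 * (neg1 * X) - + 1) - - (+ 2)) + - (neg1 * X) + - (+ 2))
                           ≡ (- (+ 3 + t) - + 1) - neg1 * (neg1 * (neg1 * X))
              ring = solve-∀

    A-odd : ∀ m → 2 ≤ m → m ≤ q → neg1 ^ m ≡ neg1 → A m ≅ - (+ m) [ p ]
    A-odd (suc zero) (s≤s ()) _ _
    A-odd (suc (suc t)) _ m≤q odd = ≅-trans (A-closed t m≤q)
      (≅-reflexive (trans (cong (λ u → (- (+ suc (suc t)) - + 1) - u) odd) (cancel-one (+ suc (suc t)))))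
      where cancel-one : ∀ m → (- m - + 1) - neg1 ≡ - m
            cancel-one = solve-∀

    sψ-power : ∀ (ψ : ℕ → Seq) k N m → (∀ b → InΔ p b → ψ b k ≅ (+ b) ^ m [ N ]) → sψ q' ψ k ≅ - A m [ N ]
    sψ-power ψ k N m ψ≅power = ≅-trans (≅-reflexive (sumℤ≡∑ q' _))
      (≅-trans (∑-cong≅ q' (λ j j<q' → ≅-*l (recip j)
                 (≅-- (≅-+ (ψ≅power 1 1∈Δ) (ψ≅power (suc j) (s≤s z≤n , s≤s (s≤s (ℕP.<⇒≤ j<q')))))
                      (ψ≅power (suc (suc j)) (s≤s z≤n , s≤s (s≤s j<q'))))))
               (≅-reflexive as-A))
      where
      open ≡-Reasoning
      negate : ∀ X P → + 1 + X - P ≡ - ((P - X) - + 1)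
      negate = solve-∀
      as-A : ∑ q' (λ j → recip j * ((+ 1) ^ m + (+ suc j) ^ m - (+ suc (suc j)) ^ m)) ≡ - A m
      as-A = begin
        ∑ q' (λ j → recip j * ((+ 1) ^ m + (+ suc j) ^ m - (+ suc (suc j)) ^ m))
          ≡⟨ ∑-cong q' (λ j _ → cong (recip j *_) (trans (cong₂ (λ u v → u + (+ suc j) ^ m - v ^ m) (ℤP.^-zeroˡ m) (ℤP.pos-+ 1 (suc j)))
                                                          (negate ((+ suc j) ^ m) ((+ 1 + + suc j) ^ m)))) ⟩
        ∑ q' (λ j → recip j * - δ m (+ suc j))   ≡⟨ ∑-cong q' (λ j _ → sym (ℤP.neg-distribʳ-* (recip j) (δ m (+ suc j)))) ⟩
        ∑ q' (λ j → - (recip j * δ m (+ suc j))) ≡⟨ ∑-neg q' _ ⟩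
        - A m ∎

module PadicUnits where

  open import Data.Nat as ℕ using (ℕ; zero; suc)
  import Data.Nat.Properties as ℕP
  import Data.Nat.Divisibility as ℕD
  open import Data.Integer using (+_; -_; _-_; _+_; _*_; _^_)
  import Data.Integer.Properties as ℤP
  import Data.Integer.Divisibility.Signed as S
  open import Data.Integer.Tactic.RingSolver using (solve-∀)
  open import Relation.Binary.PropositionalEquality
  open import Data.Product using (_,_)
  open import Relation.Nullary using (¬_)
  open import Data.Nat.Primality using (Prime)
  open import Defs
  open Congruence
  open Binomial

  -- A p-adic integer u with u ≢ 0 (mod p) is a unit of ℤ_p.  Its inverse is built by
  -- Newton's iteration v ↦ v (2 - u v), which squares the error 1 - u v at each step.
  module Unit {q' : ℕ} (pr : Prime (suc (suc q'))) (u : Seq) (u-Zp : IsZp (suc (suc q')) u)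
              (u≇0 : ¬ (u 1 ≅ + 0 [ suc (suc q') ])) where
    p = suc (suc q')

    -- the inverse, v_1 = u_1^(p-2) by Fermat
    v : Seq
    v zero = u 1 ^ q'
    v (suc zero) = u 1 ^ q'
    v (suc (suc j)) = v (suc j) * (+ 2 - u (suc (suc j)) * v (suc j))

    u-step : ∀ j → u (suc j) ≅ u j [ p ℕ.^ j ]
    u-step j = fromU (u-Zp j)

    uv≅1 : ∀ j → u (suc j) * v (suc j) ≅ + 1 [ p ℕ.^ suc j ]
    uv≅1 zero = ≅-modulus (sym (ℕP.*-identityʳ p)) (fermatℤ pr (u 1) u≇0)
    uv≅1 (suc j) = diff≅0⇒≅ (≅-trans (≅-reflexive (newton (u (suc (suc j))) (v (suc j))))
                                     (≅-weaken square-divides (≅-neg (≅0-* error≅0 error≅0))))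
      where
      P = p ℕ.^ suc j
      error≅0 : + 1 - u (suc (suc j)) * v (suc j) ≅ + 0 [ P ]
      error≅0 = ≅⇒diff≅0 (≅-sym (≅-trans (≅-*r (v (suc j)) (u-step (suc j))) (uv≅1 j)))
      newton : ∀ u v → u * (v * (+ 2 - u * v)) - + 1 ≡ - ((+ 1 - u * v) * (+ 1 - u * v))
      newton = solve-∀
      square-divides : p ℕ.^ suc (suc j) ℕD.∣ P ℕ.* P
      square-divides = ℕD.divides (p ℕ.^ j) (begin
        P ℕ.* P                       ≡⟨ ℕP.^-distribˡ-+-* p (suc j) (suc j) ⟨
        p ℕ.^ (suc j ℕ.+ suc j)       ≡⟨ cong (λ n → p ℕ.^ suc n) (ℕP.+-suc j j) ⟩
        p ℕ.^ (suc (suc j) ℕ.+ j)     ≡⟨ ℕP.^-distribˡ-+-* p (suc (suc j)) j ⟩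
        p ℕ.^ suc (suc j) ℕ.* p ℕ.^ j ≡⟨ ℕP.*-comm (p ℕ.^ suc (suc j)) (p ℕ.^ j) ⟩
        p ℕ.^ j ℕ.* p ℕ.^ suc (suc j) ∎)
        where open ≡-Reasoning

    v-Zp : IsZp p v
    v-Zp zero = toU {a = v 1} {b = v 0} ≅-mod-1
    v-Zp (suc j) = toU {a = v (suc (suc j))} {b = v (suc j)} (diff≅0⇒≅ (≅-trans (≅-reflexive (factor (v (suc j)) (u (suc (suc j)))))
                     (≅-trans (≅-*l (v (suc j)) (≅⇒diff≅0 (≅-sym (≅-trans (≅-*r (v (suc j)) (u-step (suc j))) (uv≅1 j)))))
                              (≅-reflexive (ℤP.*-zeroʳ (v (suc j)))))))
      where factor : ∀ v u → v * (+ 2 - u * v) - v ≡ v * (+ 1 - u * v)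
            factor = solve-∀

    unit : IsUnit p u
    unit = u-Zp , v , v-Zp , λ { zero → toU {a = u 0 * v 0} {b = + 1} ≅-mod-1 ; (suc j) → toU (uv≅1 j) }

  module DivideByP {q : ℕ} (x : Seq) (x-Zp : IsZp (suc q) x) (x≅0 : ∀ k → x (suc k) ≅ + 0 [ suc q ]) where
    p = suc q

    w : Seq
    w k = S.quotient (≅0⇒∣ (x≅0 k))

    x≡w*p : ∀ k → x (suc k) ≡ w k * + p
    x≡w*p k = S._∣_.equality (≅0⇒∣ (x≅0 k))

    -- (w_(k+1) - w_k) p = x_(k+2) - x_(k+1) is divisible by p^(k+1); cancel one p.
    w-Zp : IsZp p w
    w-Zp k = toU {a = w (suc k)} {b = w k} (mk (S.divides Q (ℤP.*-cancelʳ-≡ (w (suc k) - w k) (Q * + (p ℕ.^ k)) (+ p) scaled)))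
      where
      difference≅0 : (w (suc k) - w k) * + p ≅ + 0 [ p ℕ.^ suc k ]
      difference≅0 = ≅-trans (≅-reflexive (ℤP.*-distribʳ-+ (+ p) (w (suc k)) (- w k)))
        (≅-trans (≅-reflexive (cong (λ u → w (suc k) * + p + u) (sym (ℤP.neg-distribˡ-* (w k) (+ p)))))
                 (≅⇒diff≅0 (≅-trans (≅-reflexive (sym (x≡w*p (suc k)))) (≅-trans (fromU (x-Zp (suc k))) (≅-reflexive (x≡w*p k))))))
      Q = S.quotient (≅0⇒∣ difference≅0)
      scaled : (w (suc k) - w k) * + p ≡ Q * + (p ℕ.^ k) * + p
      scaled = trans (S._∣_.equality (≅0⇒∣ difference≅0))
                     (trans (cong (Q *_) (trans (cong +_ (ℕP.*-comm p (p ℕ.^ k))) (ℤP.pos-* (p ℕ.^ k) p))) (sym (ℤP.*-assoc Q _ _)))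

-- The Teichmüller character is determined by its reduction modulo p.
module Teichmuller where

  open import Data.Nat as ℕ using (ℕ; zero; suc)
  import Data.Nat.Properties as ℕP
  import Data.Nat.Divisibility as ℕD
  import Data.Nat.Tactic.RingSolver as ℕSolver
  open import Data.Integer using (+_; _*_; _^_)
  import Data.Integer.Properties as ℤP
  open import Relation.Binary.PropositionalEquality
  open import Data.Product using (_,_; proj₁; proj₂)
  open import Data.Nat.Primality using (Prime)
  open import Defs
  open Congruence
  open Binomial
  open Powers
  open UnitGroup

  -- repunit n k = 1 + n + ... + n^(k-1), so that (1 + q)^k = 1 + q · repunit (1 + q) k.
  repunit : ℕ → ℕ → ℕ
  repunit n zero = 0
  repunit n (suc k) = n ℕ.^ k ℕ.+ repunit n k

  power≡1+q*repunit : ∀ q k → suc q ℕ.^ k ≡ suc (q ℕ.* repunit (suc q) k)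
  power≡1+q*repunit q zero = cong suc (sym (ℕP.*-zeroʳ q))
  power≡1+q*repunit q (suc k) = trans (cong (λ u → u ℕ.+ q ℕ.* suc q ℕ.^ k) (power≡1+q*repunit q k))
                                      (regroup q (suc q ℕ.^ k) (repunit (suc q) k))
    where regroup : ∀ q P N → suc (q ℕ.* N) ℕ.+ q ℕ.* P ≡ suc (q ℕ.* (P ℕ.+ N))
          regroup = ℕSolver.solve-∀

  -- The Teichmüller character is the only character lifting b ↦ b (mod p):
  -- every ψ(a) is a (p-1)-st root of unity at each precision, hence fixed by x ↦ x^(p^k),
  -- while ψ(a)^(p^k) ≡ a^(p^k) = ω(a) modulo p^(k+1) by lifting the exponent.
  module Uniqueness {q' : ℕ} (pr : Prime (suc (suc q'))) (ψ : ℕ → Seq) (ψ-char : IsChar (suc (suc q')) ψ)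
    (ψ≅id : ∀ a → InΔ (suc (suc q')) a → ψ a 1 ≅ + a [ suc (suc q') ]) where
    open Δ pr

    ψ-mult : ∀ a b → InΔ p a → InΔ p b → ∀ k → ψ (mulΔ p a b) k ≅ ψ a k * ψ b k [ p ℕ.^ k ]
    ψ-mult a b a∈Δ b∈Δ k = fromU (proj₂ ψ-char a b a∈Δ b∈Δ k)

    -- ψ(1) = ψ(1)², and ψ(1) is invertible.
    ψ1≅1 : ∀ k → ψ 1 k ≅ + 1 [ p ℕ.^ k ]
    ψ1≅1 k = ≅-sym (≅-trans (≅-sym xy≅1) (≅-trans (≅-*r y (ψ-mult 1 1 1∈Δ 1∈Δ k))
                                      (≅-trans (≅-reflexive (ℤP.*-assoc x x y)) (≅-trans (≅-*l x xy≅1) (≅-reflexive (ℤP.*-identityʳ x))))))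
      where
      x = ψ 1 k
      inverse = proj₂ (proj₁ ψ-char 1 1∈Δ)
      y = proj₁ inverse k
      xy≅1 : x * y ≅ + 1 [ p ℕ.^ k ]
      xy≅1 = fromU (proj₂ (proj₂ inverse) k)

    module At (a : ℕ) (a∈Δ : InΔ p a) where
      power : ℕ → ℕ
      power zero = 1
      power (suc j) = mulΔ p (power j) a

      power-in : ∀ j → InΔ p (power j)
      power-in zero = 1∈Δ
      power-in (suc j) = mulΔ-in (power-in j) a∈Δ

      power-≅ : ∀ j → + power j ≅ (+ a) ^ j [ p ]
      power-≅ zero = ≅-refl
      power-≅ (suc j) = ≅-trans (mulΔ-≅ (power j) a) (≅-trans (≅-*r (+ a) (power-≅ j)) (≅-reflexive (ℤP.*-comm ((+ a) ^ j) (+ a))))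

      ψ-power : ∀ k j → ψ (power j) k ≅ (ψ a k) ^ j [ p ℕ.^ k ]
      ψ-power k zero = ψ1≅1 k
      ψ-power k (suc j) = ≅-trans (ψ-mult (power j) a (power-in j) a∈Δ k)
                                  (≅-trans (≅-*r (ψ a k) (ψ-power k j)) (≅-reflexive (ℤP.*-comm _ (ψ a k))))

      power-q≡1 : power q ≡ 1
      power-q≡1 = residue-≅⇒≡ (proj₂ (power-in q)) (proj₂ 1∈Δ) (≅-trans (power-≅ q) (fermat-unit pr a (proj₁ a∈Δ) (proj₂ a∈Δ)))

      ψ^q≅1 : ∀ k → (ψ a k) ^ q ≅ + 1 [ p ℕ.^ k ]
      ψ^q≅1 k = ≅-trans (≅-sym (ψ-power k q)) (≅-trans (≅-reflexive (cong (λ u → ψ u k) power-q≡1)) (ψ1≅1 k))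

      ψ^p^k≅ψ : ∀ k → (ψ a k) ^ (p ℕ.^ k) ≅ ψ a k [ p ℕ.^ k ]
      ψ^p^k≅ψ k = ≅-trans (≅-reflexive (trans (cong (ψ a k ^_) (power≡1+q*repunit q k))
                                              (cong (ψ a k *_) (sym (ℤP.^-*-assoc (ψ a k) q (repunit p k))))))
                  (≅-trans (≅-*l (ψ a k) (≅-^ (ψ^q≅1 k) (repunit p k)))
                           (≅-reflexive (trans (cong (ψ a k *_) (ℤP.^-zeroˡ (repunit p k))) (ℤP.*-identityʳ (ψ a k)))))

      ψ-mod-p : ∀ j → ψ a (suc j) ≅ ψ a 1 [ p ]
      ψ-mod-p zero = ≅-refl
      ψ-mod-p (suc j) = ≅-trans (≅-weaken (ℕD.divides (p ℕ.^ j) (ℕP.*-comm p (p ℕ.^ j))) (fromU (proj₁ (proj₁ ψ-char a a∈Δ) (suc j))))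
                                (ψ-mod-p j)

      ψ≈ω : ψ a ≈[ p ] ω p a
      ψ≈ω zero = toU {a = ψ a 0} {b = ω p a 0} ≅-mod-1
      ψ≈ω (suc j) = toU (≅-trans (≅-sym (ψ^p^k≅ψ (suc j)))
                     (≅-weaken (ℕD.divides p refl) (lift (suc j) (ψ a (suc j)) (+ a) (≅-trans (ψ-mod-p j) (ψ≅id a a∈Δ)))))

module PartA where

  open import Data.Nat as ℕ using (ℕ; zero; suc; _<_; _≤_; s≤s; z≤n)
  import Data.Nat.Properties as ℕP
  open import Data.Integer using (ℤ; +_; _+_; _*_; _^_)
  import Data.Integer.Properties as ℤP
  open import Relation.Binary.PropositionalEquality
  open import Data.Empty using (⊥; ⊥-elim)
  open import Data.Sum using (inj₁; inj₂)
  open import Data.Product using (Σ; _×_; _,_; proj₁; proj₂)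
  open import Relation.Nullary using (¬_)
  open import Data.Nat.Primality using (Prime)
  open import Defs
  open Congruence
  open UnitGroup
  open GroupRing
  open CharactersModP
  open TwistedSums
  open PadicUnits
  open Teichmuller

  -- Part (a): for odd ψ ≠ ω, e_ψ s = s_ψ e_ψ with s_ψ a unit.  Modulo p, ψ is
  -- b ↦ b^m; oddness makes m odd, ψ ≠ ω excludes m = 1, and then s_ψ ≡ -A_m ≡ m ≢ 0.
  module OddCharacter {q' : ℕ} (pr : Prime (suc (suc q'))) (p≥5 : 5 ≤ suc (suc q')) (ψ : ℕ → Seq)
    (ψ-char : IsChar (suc (suc q')) ψ) (ψ-odd : IsOdd (suc (suc q')) ψ)
    (ψ≠ω : ¬ (∀ a → InΔ (suc (suc q')) a → ψ a ≈[ suc (suc q') ] ω (suc (suc q')) a)) where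
    open Δ pr
    open Twisted pr using (A; A-odd; sψ-power)

    ψ-mult : ∀ a b → InΔ p a → InΔ p b → ψ (mulΔ p a b) ≈[ p ] (ψ a ⊗ ψ b)
    ψ-mult = proj₂ ψ-char

    open Convolution pr ψ ψ-mult using (eψ⋆s≅)

    χ : ℕ → ℤ
    χ a = ψ a 1

    mod-p : ∀ {x y} → x ≅ y [ p ℕ.^ 1 ] → x ≅ y [ p ]
    mod-p = ≅-modulus (ℕP.*-identityʳ p)

    χ-mult : ∀ a b → InΔ p a → InΔ p b → χ (mulΔ p a b) ≅ χ a * χ b [ p ]
    χ-mult a b a∈Δ b∈Δ = mod-p (fromU (ψ-mult a b a∈Δ b∈Δ 1))

    -- χ(a) has the inverse of ψ(a) modulo p
    χ≇0 : ∀ a → InΔ p a → ¬ (χ a ≅ + 0 [ p ])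
    χ≇0 a a∈Δ χa≅0 = small-≇0 (s≤s z≤n) (proj₂ 1∈Δ)
      (≅-trans (≅-sym (mod-p (fromU (proj₂ (proj₂ inverse) 1)))) (≅-trans (≅-*r (proj₁ inverse 1) χa≅0) (≅-reflexive (ℤP.*-zeroˡ (proj₁ inverse 1)))))
      where inverse = proj₂ (proj₁ ψ-char a a∈Δ)

    open Characters pr χ χ-mult χ≇0 using (character-is-power)

    -- An even exponent would give -1 ≡ χ(p-1) ≡ (p-1)^m ≡ 1, i.e. p ∣ 2.
    exponent-odd : ∀ m → (∀ b → InΔ p b → χ b ≅ (+ b) ^ m [ p ]) → neg1 ^ m ≡ neg1
    exponent-odd m χ≅power with neg1-power m
    ... | inj₂ odd = odd
    ... | inj₁ even = ⊥-elim (small-≇0 {n = 2} (s≤s z≤n) (ℕP.≤-trans (s≤s (s≤s (s≤s z≤n))) p≥5) two≅0)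
      where
      -1≅1 : neg1 ≅ + 1 [ p ]
      -1≅1 = ≅-trans (≅-sym (mod-p (fromU (ψ-odd 1))))
                     (≅-trans (χ≅power q (s≤s z≤n , ℕP.≤-refl)) (≅-trans (≅-^ q≅-1 m) (≅-reflexive even)))
      two≅0 : + 2 ≅ + 0 [ p ]
      two≅0 = ≅-trans (≅-+ (≅-sym -1≅1) (≅-refl {+ 1})) (≅-reflexive refl)

    -- The exponent 1 would make ψ the Teichmüller character.
    exponent-≢1 : (∀ b → InΔ p b → χ b ≅ (+ b) ^ 1 [ p ]) → ⊥
    exponent-≢1 χ≅id = ψ≠ω (λ a a∈Δ → Uniqueness.At.ψ≈ω pr ψ ψ-char
                                (λ b b∈Δ → ≅-trans (χ≅id b b∈Δ) (≅-reflexive (ℤP.*-identityʳ (+ b)))) a a∈Δ)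

    -- No admissible exponent m makes s_ψ vanish: m = 0 is even, m = 1 is ω, and for odd m ≥ 3
    -- s_ψ ≡ -A_m ≡ m.
    exponent-excluded : ∀ m → m < q → (∀ b → InΔ p b → χ b ≅ (+ b) ^ m [ p ]) → neg1 ^ m ≡ neg1 →
                        ¬ (sψ q' ψ 1 ≅ + 0 [ p ])
    exponent-excluded zero _ _ () _
    exponent-excluded (suc zero) _ χ≅id _ _ = exponent-≢1 χ≅id
    exponent-excluded (suc (suc t)) m<q χ≅power odd sψ≅0 = small-≇0 {n = suc (suc t)} (s≤s z≤n) (ℕP.m<n⇒m<1+n m<q)
      (≅-trans (≅-reflexive (sym (ℤP.neg-involutive (+ suc (suc t)))))
               (≅-trans (≅-neg (≅-sym (A-odd (suc (suc t)) (s≤s (s≤s z≤n)) (ℕP.<⇒≤ m<q) odd)))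
                        (≅-trans (≅-sym (sψ-power ψ 1 p (suc (suc t)) χ≅power)) sψ≅0)))

    sψ≇0 : ¬ (sψ q' ψ 1 ≅ + 0 [ p ])
    sψ≇0 = from-power character-is-power
      where from-power : Σ ℕ (λ m → m < q × (∀ b → InΔ p b → χ b ≅ (+ b) ^ m [ p ])) → ¬ (sψ q' ψ 1 ≅ + 0 [ p ])
            from-power (m , m<q , χ≅power) = exponent-excluded m m<q χ≅power (exponent-odd m χ≅power)

    result : Σ Seq (λ u → IsUnit p u × ((e p ψ ⋆[ p ] s p) ≈GR[ p ] (u · e p ψ)))
    result = sψ q' ψ
           , Unit.unit pr (sψ q' ψ) (sψ-Zp q' ψ (λ a a∈Δ → proj₁ (proj₁ ψ-char a a∈Δ))) sψ≇0
           , λ c c∈Δ k → toU (eψ⋆s≅ c c∈Δ k)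

module PartB where

  open import Data.Nat as ℕ using (ℕ; zero; suc; _<_; _≤_; s≤s; z≤n)
  import Data.Nat.Properties as ℕP
  import Data.Nat.Divisibility as ℕD
  open import Data.Nat.Combinatorics using (_C_; nCn≡1; nC1≡n)
  open import Data.Integer using (ℤ; +_; -_; _-_; _+_; _*_; _^_)
  import Data.Integer.Properties as ℤP
  open import Data.Integer.Tactic.RingSolver using (solve-∀)
  open import Relation.Binary.PropositionalEquality
  open import Data.Empty using (⊥-elim)
  open import Data.Sum using (inj₁; inj₂)
  open import Data.Product using (Σ; _×_; _,_)
  open import Relation.Nullary using (¬_)
  open import Data.Nat.Primality using (Prime; composite)
  import Data.Integer.Divisibility.Signed as S
  open import Defs
  open Congruence
  open FiniteSum
  open Binomial
  open Powers
  open UnitGroup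
  open GroupRing
  open TwistedSums
  open PadicUnits

  neg1-even : ∀ m → neg1 ^ m ≡ + 1 → 2 ℕD.∣ m
  neg1-even zero _ = ℕD.divides 0 refl
  neg1-even (suc (suc m)) even = ℕD.∣m∣n⇒∣m+n (ℕD.∣-refl {2}) (neg1-even m (trans (sym (square (neg1 ^ m))) even))
    where square : ∀ X → neg1 * (neg1 * X) ≡ X
          square = solve-∀

  -- Part (b): e_ω s = s_ω e_ω where s_ω ≡ 0 (mod p) and s_ω ≡ p (mod p²), so s_ω = p u
  -- with u a unit.  Modulo p², ω(b) ≡ b^p, which reduces s_ω to -A_p; expanding
  -- δ_p(n) = (1+n)^p - n^p - 1 binomially gives A_p ≡ p (p-1) ≡ -p (mod p²).
  module TeichmullerCase {q' : ℕ} (pr : Prime (suc (suc q'))) (p≥5 : 5 ≤ suc (suc q')) where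
    open Δ pr
    open Twisted pr using (A; recip; S; S-small≅; sψ-power; A1≡0)

    p² = p ℕ.* p

    p-odd : neg1 ^ p ≡ neg1
    p-odd with neg1-power p
    ... | inj₂ odd = odd
    ... | inj₁ even = ⊥-elim (Prime.notComposite pr (composite {2} (ℕP.≤-trans (s≤s (s≤s (s≤s z≤n))) p≥5) (neg1-even p even)))

    ω-step : ∀ a k → (+ a) ^ (p ℕ.^ suc k) ≅ (+ a) ^ (p ℕ.^ k) [ p ℕ.^ suc k ]
    ω-step a k = ≅-trans (≅-reflexive (sym (ℤP.^-*-assoc (+ a) p (p ℕ.^ k)))) (lift k ((+ a) ^ p) (+ a) (fermat pr a))

    ω-Zp : ∀ a → IsZp p (ω p a)
    ω-Zp a k = toU (≅-weaken (ℕD.divides p refl) (ω-step a k))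

    ω-mod-p : ∀ a k → (+ a) ^ (p ℕ.^ k) ≅ (+ a) ^ 1 [ p ]
    ω-mod-p a zero = ≅-refl
    ω-mod-p a (suc k) = ≅-trans (≅-weaken (ℕD.divides (p ℕ.^ k) (ℕP.*-comm p (p ℕ.^ k))) (ω-step a k)) (ω-mod-p a k)

    ω-mod-p² : ∀ a → (+ a) ^ (p ℕ.^ 2) ≅ (+ a) ^ p [ p² ]
    ω-mod-p² a = ≅-modulus (cong (p ℕ.*_) (ℕP.*-identityʳ p))
      (≅-trans (ω-step a 1) (≅-reflexive (cong ((+ a) ^_) (ℕP.*-identityʳ p))))

    ω-mult : ∀ a b → InΔ p a → InΔ p b → ω p (mulΔ p a b) ≈[ p ] (ω p a ⊗ ω p b)
    ω-mult a b _ _ k = toU (≅-weaken (ℕD.divides p refl)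
      (≅-trans (lift k _ _ (mulΔ-≅ a b)) (≅-reflexive (^-distribʳ-* (+ a) (+ b) (p ℕ.^ k)))))

    open Convolution pr (ω p) ω-mult using (eψ⋆s≅)

    sω = sψ q' (ω p)

    sω-Zp : IsZp p sω
    sω-Zp = sψ-Zp q' (ω p) (λ a _ → ω-Zp a)

    -- Modulo p, ω is the identity, for which the sum A_1 vanishes.
    sω≅0 : ∀ k → sω (suc k) ≅ + 0 [ p ]
    sω≅0 k = ≅-trans (sψ-power (ω p) (suc k) p 1 (λ b _ → ω-mod-p b (suc k))) (≅-neg (≅-reflexive A1≡0))

    open DivideByP sω sω-Zp sω≅0 using (w; w-Zp; x≡w*p)

    δ-binomial : ∀ x → δ p x ≡ ∑ q (λ i → + (p C suc i) * x ^ suc i)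
    δ-binomial x = trans (cong (λ u → (u - x ^ p) - + 1) (trans (binomial x p) (cong (_+ T p) (∑-first q T))))
                         (trans (cong (λ u → ((T 0 + R + + u * x ^ p) - x ^ p) - + 1) (nCn≡1 p)) (cancel-ends R (x ^ p)))
      where
      T : ℕ → ℤ
      T i = + (p C i) * x ^ i
      R = ∑ q (λ i → T (suc i))
      cancel-ends : ∀ R X → ((+ 1 * + 1 + R + + 1 * X) - X) - + 1 ≡ R
      cancel-ends = solve-∀

    -- Since p ∣ C(p,i+1), the factor n⁻¹ n ≡ 1 (mod p) may be dropped modulo p².
    summand≅ : ∀ j → j < q' → recip j * δ p (+ suc j) ≅ ∑ q (λ i → + (p C suc i) * (+ suc j) ^ i) [ p² ]
    summand≅ j j<q' =
      ≅-trans (≅-reflexive (trans (cong (recip j *_) (δ-binomial x)) (trans (sym (∑-*l q (recip j) _))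
                                                                       (∑-cong q (λ i _ → reorder (recip j) (+ (p C suc i)) x (x ^ i))))))
      (≅-trans (∑-cong≅ q (λ i i<q → ≅0-*-≅ (prime∣C≅0 pr i (s≤s i<q)) (≅-*r (x ^ i) n⁻¹n≅1)))
               (≅-reflexive (∑-cong q (λ i _ → cong (+ (p C suc i) *_) (ℤP.*-identityˡ (x ^ i))))))
      where
      x = + suc j
      n⁻¹n≅1 : recip j * x ≅ + 1 [ p ]
      n⁻¹n≅1 = ≅-trans (≅-reflexive (ℤP.*-comm (recip j) x)) (inv-≅ (suc j) (s≤s z≤n , s≤s (s≤s (ℕP.<⇒≤ j<q'))))
      reorder : ∀ v b x X → v * (b * (x * X)) ≡ b * (v * x * X)
      reorder = solve-∀

    S-value : ℕ → ℤ
    S-value zero = + q'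
    S-value (suc i) = neg1 ^ suc (suc i)

    S≅ : ∀ i → i < q → S i ≅ S-value i [ p ]
    S≅ zero _ = ≅-reflexive (trans (∑-const q' (+ 1)) (ℤP.*-identityʳ (+ q')))
    S≅ (suc i) i+1<q = ≅-trans (S-small≅ (suc i) (s≤s z≤n) i+1<q) (≅-reflexive (negate (neg1 ^ suc i)))
      where negate : ∀ X → - X ≡ neg1 * X
            negate = solve-∀

    -- ∑_{i ≥ 1} C(p,i+1) (-1)^(i+1) = p, from (1 + (-1))^p = 0.
    alternating : ∑ q' (λ i → + (p C suc (suc i)) * neg1 ^ suc (suc i)) ≡ + p
    alternating = trans (sym (trans (cong (λ u → R - u) expansion≡0) (ℤP.+-identityʳ R))) (isolate R (+ p))
      where
      R = ∑ q' (λ i → + (p C suc (suc i)) * neg1 ^ suc (suc i))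
      T : ℕ → ℤ
      T i = + (p C i) * neg1 ^ i
      expansion≡0 : (+ 1 * + 1 + (+ p * (neg1 * + 1) + R)) + + 1 * neg1 ≡ + 0
      expansion≡0 = sym (begin
        + 0                 ≡⟨ sym (ℤP.*-zeroˡ ((+ 0) ^ q)) ⟩
        (+ 1 + neg1) ^ p    ≡⟨ binomial neg1 p ⟩
        ∑ (suc p) T         ≡⟨ cong (_+ T p) (trans (∑-first q T) (cong (λ u → T 0 + u) (∑-first q' (λ i → T (suc i))))) ⟩
        (T 0 + (T 1 + R)) + T p
          ≡⟨ cong₂ (λ u v → (T 0 + (+ u * (neg1 * + 1) + R)) + + v * neg1 ^ p) (nC1≡n p) (nCn≡1 p) ⟩
        (+ 1 * + 1 + (+ p * (neg1 * + 1) + R)) + + 1 * neg1 ^ p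
          ≡⟨ cong (λ u → (+ 1 * + 1 + (+ p * (neg1 * + 1) + R)) + + 1 * u) p-odd ⟩
        (+ 1 * + 1 + (+ p * (neg1 * + 1) + R)) + + 1 * neg1 ∎)
        where open ≡-Reasoning
      isolate : ∀ R P → R - ((+ 1 * + 1 + (P * (neg1 * + 1) + R)) + + 1 * neg1) ≡ P
      isolate = solve-∀

    A-p≅ : A p ≅ + p * + q [ p² ]
    A-p≅ = ≅-trans (∑-cong≅ q' summand≅)
           (≅-trans (≅-reflexive swap-sums)
           (≅-trans (∑-cong≅ q (λ i i<q → ≅0-*-≅ (prime∣C≅0 pr i (s≤s i<q)) (S≅ i i<q)))
                    (≅-reflexive evaluate)))
      where
      open ≡-Reasoning
      swap-sums : ∑ q' (λ j → ∑ q (λ i → + (p C suc i) * (+ suc j) ^ i)) ≡ ∑ q (λ i → + (p C suc i) * S i)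
      swap-sums = trans (∑-swap q' q _) (∑-cong q (λ i _ → ∑-*l q' (+ (p C suc i)) _))
      evaluate : ∑ q (λ i → + (p C suc i) * S-value i) ≡ + p * + q
      evaluate = begin
        ∑ q (λ i → + (p C suc i) * S-value i)   ≡⟨ ∑-first q' _ ⟩
        + (p C 1) * + q' + ∑ q' (λ i → + (p C suc (suc i)) * neg1 ^ suc (suc i))
          ≡⟨ cong₂ (λ u v → + u * + q' + v) (nC1≡n p) alternating ⟩
        + p * + q' + + p                        ≡⟨ factor (+ p) (+ q') ⟩
        + p * (+ 1 + + q')                      ≡⟨ cong (+ p *_) (sym (ℤP.pos-+ 1 q')) ⟩
        + p * + q                               ∎
        where factor : ∀ P Q → P * Q + P ≡ P * (+ 1 + Q)
              factor = solve-∀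

    -- s_ω ≡ -A_p ≡ -p (p-1) ≡ p (mod p²)
    sω≅p : sω 2 ≅ + p [ p² ]
    sω≅p = ≅-trans (sψ-power (ω p) 2 p² p (λ b _ → ω-mod-p² b))
                   (≅-trans (≅-neg A-p≅) (≅-from-∣ collect (S.divides (- (+ 1)) refl)))
      where
      expand : ∀ Q → - ((+ 1 + Q) * Q) - (+ 1 + Q) ≡ - (+ 1) * ((+ 1 + Q) * (+ 1 + Q))
      expand = solve-∀
      collect : - (+ p * + q) - + p ≡ - (+ 1) * + p²
      collect = trans (cong (λ u → - (u * + q) - u) (ℤP.pos-+ 1 q))
                      (trans (expand (+ q)) (cong (- (+ 1) *_) (trans (cong₂ _*_ (sym (ℤP.pos-+ 1 q)) (sym (ℤP.pos-+ 1 q)))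
                                                                     (sym (ℤP.pos-* p p)))))

    w≇0 : ¬ (w 1 ≅ + 0 [ p ])
    w≇0 w1≅0 = small-≇0 {n = p} {m = p²} (s≤s z≤n) p<p²
      (≅-trans (≅-sym sω≅p) (≅-trans (≅-reflexive (x≡w*p 1)) (≅0-* w1≅0 (∣⇒≅0 {m = p} (S.divides (+ 1) (sym (ℤP.*-identityˡ (+ p))))))))
      where p<p² : p < p²
            p<p² = subst (_< p²) (ℕP.*-identityʳ p) (ℕP.*-monoʳ-< p (s≤s (s≤s z≤n)))

    result : Σ Seq (λ u → IsUnit p u × ((e p (ω p) ⋆[ p ] s p) ≈GR[ p ] ((cst (+ p) ⊗ u) · e p (ω p))))
    result = w , Unit.unit pr w w-Zp w≇0 , λ c c∈Δ k → toU (≅-trans (eψ⋆s≅ c c∈Δ k)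
               (≅-*r (invPm1 p k * ω p (inv p c) k)
                     (≅-trans (≅-sym (fromU (sω-Zp k))) (≅-reflexive (trans (x≡w*p k) (ℤP.*-comm (w k) (+ p)))))))

open Defs

lemma2p4 : (p : ℕ) → .{{_ : NonZero p}} → Prime p → 5 ≤ p →
    ((ψ : ℕ → Defs.Seq) → IsChar p ψ → IsOdd p ψ → ¬ (∀ a → InΔ p a → ψ a ≈[ p ] ω p a) →
    Σ Seq (λ u → IsUnit p u × ((e p ψ ⋆[ p ] s p) ≈GR[ p ] (u · e p ψ))))
    × Σ Seq (λ u → IsUnit p u × ((e p (ω p) ⋆[ p ] s p) ≈GR[ p ] ((cst (+ p) ⊗ u) · e p (ω p))))
lemma2p4 zero p-prime ()
lemma2p4 (suc zero) p-prime (s≤s ())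
lemma2p4 (suc (suc q')) p-prime p≥5 =
  (λ ψ ψ-char ψ-odd ψ≠ω → PartA.OddCharacter.result p-prime p≥5 ψ ψ-char ψ-odd ψ≠ω) ,
  PartB.TeichmullerCase.result p-prime p≥5
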